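{- Let $f=c_1x_1^k+c_2x_2^k+\cdots+c_tx_t^k$ with $c_1,\ldots,c_t\in\mathbb{Z}$ and $k\geq 1$, let $p$ be a prime not dividing any of $c_1,\ldots,c_t$, and suppose some exponent $e$ of $p$ in $f$ divides $k$. For $2\leq j\leq k+1$ let $n_j=|N_{p^j}|$. Then for all $n\geq 1$: (i) if $n\equiv 1\pmod k$, then \[\alpha(p^n)=p^{n-1}\alpha(p)-\frac{p^{n-1}-1}{p^k-1}\sum_{j=2}^{k+1}n_jp^{k-j+1};\] (ii) if $n\equiv r\pmod k$ with $2\leq r\leq k$, then \[\alpha(p^n)=p^{n-1}\alpha(p)-\frac{p^{n-1}-p^{r-1}}{p^k-1}\sum_{j=2}^{k+1}n_jp^{k-j+1}-\sum_{j=2}^{r}n_jp^{r-j}.\]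
   Context: For a positive integer $n$, $I_n=\{0,1,\ldots,n-1\}$, $A_n$ is the set of $a\in I_n$ such that $f(x_1,\ldots,x_t)\equiv a\pmod n$ has an integer solution, and $\alpha(n)=|A_n|$. For $m\mid n$, $A_n(m)=\{a+jm: a\in A_m,\ 0\leq j<n/m\}$, and for $n\geq 1$, $N_{p^n}=A_{p^n}(p^{n-1})\setminus A_{p^n}$. A nonnegative integer $e$ is an exponent of $p$ in $f$ if whenever $p^e$ divides an integer of the form $f(m_1,\ldots,m_t)$, the quotient $f(m_1,\ldots,m_t)/p^e$ is also of the form $f(q_1,\ldots,q_t)$ for some integers $q_i$. -}

module Defs where

open import Data.Nat as ℕ using (ℕ; zero; suc; _<_; _∸_)
open import Data.Fin using (Fin; zero; suc)
open import Data.Integer as ℤ using (ℤ; +_)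
open import Data.Integer.Divisibility using () renaming (_∣_ to _∣ℤ_)
open import Data.List using (List; map; upTo)
open import Data.Nat.ListAction using (sum)
open import Data.Product using (Σ; ∃; _×_)
open import Relation.Nullary using (¬_)
open import Relation.Binary.PropositionalEquality using (_≡_)
open import Function.Definitions using (Injective)

sumFin : ∀ {t} → (Fin t → ℤ) → ℤ
sumFin {zero}  g = + 0
sumFin {suc t} g = g zero ℤ.+ sumFin (λ i → g (suc i))

-- Sum over j = lo, lo+1, ..., hi (empty if hi < lo) of g j (natural numbers).
sumFromTo : ℕ → ℕ → (ℕ → ℕ) → ℕ
sumFromTo lo hi g = sum (map (λ i → g (lo ℕ.+ i)) (upTo (suc hi ∸ lo)))

diagForm : ∀ {t} → (Fin t → ℤ) → ℕ → (Fin t → ℤ) → ℤ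
diagForm c k x = sumFin (λ i → c i ℤ.* (x i ℤ.^ k))

-- a ∈ A_n : a ∈ I_n (i.e. a < n) and f(x) ≡ a (mod n) has an integer solution.
InA : ∀ {t} → (Fin t → ℤ) → ℕ → ℕ → ℕ → Set
InA c k n a = a < n × ∃ λ x → (+ n) ∣ℤ (diagForm c k x ℤ.- + a)

-- b ∈ A_n(m) where n = m * q (so n/m = q):
-- b = a + j m with a ∈ A_m and 0 ≤ j < q.
InAsub : ∀ {t} → (Fin t → ℤ) → ℕ → (m q : ℕ) → ℕ → Set
InAsub c k m q b = ∃ λ a → InA c k m a × ∃ λ j → j < q × b ≡ a ℕ.+ j ℕ.* m

-- b ∈ N_{p^j} = A_{p^j}(p^{j-1}) \ A_{p^j}   (for j ≥ 1; n_{p^j}/p^{j-1} = p)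
InN : ∀ {t} → (Fin t → ℤ) → ℕ → (p j : ℕ) → ℕ → Set
InN c k p j b = InAsub c k (p ℕ.^ (j ∸ 1)) p b × ¬ InA c k (p ℕ.^ j) b

IsExponent : ∀ {t} → (Fin t → ℤ) → ℕ → (p e : ℕ) → Set
IsExponent c k p e =
  ∀ x → (+ (p ℕ.^ e)) ∣ℤ diagForm c k x →
    ∃ λ y → diagForm c k y ℤ.* + (p ℕ.^ e) ≡ diagForm c k x

-- The predicate P on ℕ has exactly s elements, all of them < bound
-- (s = |{b : P b}| where P b implies b < bound):  an injective enumeration
-- g : Fin s → ℕ of exactly the elements b < bound satisfying P.
HasSize : (bound : ℕ) → (ℕ → Set) → ℕ → Set
HasSize bound P s =
  Σ (Fin s → ℕ) λ g →
    Injective _≡_ _≡_ g ×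
    (∀ i → g i < bound × P (g i)) ×
    (∀ b → b < bound → P b → ∃ λ i → g i ≡ b)

module Submission where

-- Write α(n) = α(p^n) and n_j = |N_{p^j}|. The proof rests on two facts.
--  * Lifting count: A_{p^(n+1)}(p^n) consists of p translates of A_{p^n} and is the disjoint
--    union of A_{p^(n+1)} and N_{p^(n+1)}; hence α(n+1) + n_{n+1} = p α(n).
--  * Periodicity: n_{j+k} = n_j for j ≥ 2. By Hensel's lemma (the c_i are units mod p) every
--    element of N_{p^(j+k)} is divisible by p^k, and as an exponent of p divides k,
--    b ↦ p^k b maps N_{p^j} bijectively onto N_{p^(j+k)}.
-- Unrolling the first fact gives α(m+1) + H(m) = p^m α(1) with H(m) = Σ_{j=2}^{m+1} n_j p^(m+1-j).
-- Periodicity gives H(m+k) = H(m) + p^m H(k), so (p^k - 1) H(qk+r) = (p^k - 1) H(r) + (p^(qk+r) - p^r) H(k);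
-- both cases of the corollary follow by writing n - 1 = q k + r with 0 ≤ r < k.


module Counting where

  open import Data.Nat using (ℕ; zero; suc; _+_; _*_; _<_; _≤_; s≤s; NonZero; _%_; _/_; s≤s⁻¹)
  open import Data.Nat.Properties
  open import Data.Nat.DivMod using ([m+n]%n≡m%n; +-distrib-/-∣ˡ; n/n≡1; m<n⇒m%n≡m)
  open import Data.Nat.Divisibility using (∣-refl)
  open import Data.Fin using (Fin; zero; suc)
  open import Data.Fin.Properties using (injective⇒≤)
  open import Data.Product using (∃; _×_; _,_; proj₁; proj₂)
  open import Data.Sum using (_⊎_; inj₁; inj₂)
  open import Data.Empty using (⊥-elim)
  open import Relation.Nullary using (¬_; Dec; yes; no)
  open import Relation.Nullary.Decidable using (_×-dec_)
  open import Relation.Binary.PropositionalEquality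
  open import Function.Definitions using (Injective)
  open import Algebra.Properties.CommutativeSemigroup +-commutativeSemigroup using (interchange; x∙yz≈y∙xz)
  open import Defs using (HasSize)

  ⟦_⟧ : ∀ {P : Set} → Dec P → ℕ
  ⟦ yes _ ⟧ = 1
  ⟦ no _ ⟧ = 0

  count : {P : ℕ → Set} → (∀ b → Dec (P b)) → ℕ → ℕ
  count P? zero = 0
  count P? (suc n) = ⟦ P? n ⟧ + count P? n

  ⟦⟧-cong : ∀ {P Q : Set} (P? : Dec P) (Q? : Dec Q) → (P → Q) → (Q → P) → ⟦ P? ⟧ ≡ ⟦ Q? ⟧
  ⟦⟧-cong (yes _) (yes _) _ _ = refl
  ⟦⟧-cong (yes p) (no ¬q) f _ = ⊥-elim (¬q (f p))
  ⟦⟧-cong (no ¬p) (yes q) _ g = ⊥-elim (¬p (g q))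
  ⟦⟧-cong (no _) (no _) _ _ = refl

  count-cong : ∀ {P Q : ℕ → Set} (P? : ∀ b → Dec (P b)) (Q? : ∀ b → Dec (Q b)) n →
    (∀ b → b < n → P b → Q b) → (∀ b → b < n → Q b → P b) → count P? n ≡ count Q? n
  count-cong P? Q? zero _ _ = refl
  count-cong P? Q? (suc n) f g = cong₂ _+_
    (⟦⟧-cong (P? n) (Q? n) (f n ≤-refl) (g n ≤-refl))
    (count-cong P? Q? n (λ b b<n → f b (m<n⇒m<1+n b<n)) (λ b b<n → g b (m<n⇒m<1+n b<n)))

  count-empty : ∀ {P : ℕ → Set} (P? : ∀ b → Dec (P b)) n → (∀ b → b < n → ¬ P b) → count P? n ≡ 0
  count-empty P? zero _ = refl
  count-empty P? (suc n) h with P? n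
  ... | yes Pn = ⊥-elim (h n ≤-refl Pn)
  ... | no _ = count-empty P? n (λ b b<n → h b (m<n⇒m<1+n b<n))

  count-+ : ∀ {P : ℕ → Set} (P? : ∀ b → Dec (P b)) a n →
    count P? (a + n) ≡ count P? a + count (λ x → P? (a + x)) n
  count-+ P? a zero = trans (cong (count P?) (+-identityʳ a)) (sym (+-identityʳ _))
  count-+ P? a (suc n) = begin
    count P? (a + suc n)                                      ≡⟨ cong (count P?) (+-suc a n) ⟩
    ⟦ P? (a + n) ⟧ + count P? (a + n)                         ≡⟨ cong (⟦ P? (a + n) ⟧ +_) (count-+ P? a n) ⟩
    ⟦ P? (a + n) ⟧ + (count P? a + count (λ x → P? (a + x)) n) ≡⟨ x∙yz≈y∙xz ⟦ P? (a + n) ⟧ (count P? a) _ ⟩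
    count P? a + count (λ x → P? (a + x)) (suc n)             ∎
    where open ≡-Reasoning

  count-⊎ : ∀ {S A N : ℕ → Set} (S? : ∀ b → Dec (S b)) (A? : ∀ b → Dec (A b)) (N? : ∀ b → Dec (N b)) n →
    (∀ b → b < n → S b → A b ⊎ N b) → (∀ b → b < n → A b → S b) → (∀ b → b < n → N b → S b) →
    (∀ b → A b → ¬ N b) → count S? n ≡ count A? n + count N? n
  count-⊎ S? A? N? zero _ _ _ _ = refl
  count-⊎ S? A? N? (suc n) split fromA fromN disjoint =
    trans (cong₂ _+_ (indicator (S? n) (A? n) (N? n) (split n ≤-refl) (fromA n ≤-refl) (fromN n ≤-refl) (disjoint n))
                     (count-⊎ S? A? N? n (below split) (below fromA) (below fromN) disjoint))
          (interchange ⟦ A? n ⟧ ⟦ N? n ⟧ (count A? n) (count N? n))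
    where
    below : ∀ {X Y : ℕ → Set} → (∀ b → b < suc n → X b → Y b) → ∀ b → b < n → X b → Y b
    below h b b<n = h b (m<n⇒m<1+n b<n)
    indicator : ∀ {S A N : Set} (S? : Dec S) (A? : Dec A) (N? : Dec N) →
      (S → A ⊎ N) → (A → S) → (N → S) → (A → ¬ N) → ⟦ S? ⟧ ≡ ⟦ A? ⟧ + ⟦ N? ⟧
    indicator _ (yes a) (yes n) _ _ _ d = ⊥-elim (d a n)
    indicator (yes _) (yes _) (no _) _ _ _ _ = refl
    indicator (yes _) (no _) (yes _) _ _ _ _ = refl
    indicator (yes s) (no ¬a) (no ¬n) f _ _ _ with f s
    ... | inj₁ a = ⊥-elim (¬a a)
    ... | inj₂ n = ⊥-elim (¬n n)
    indicator (no ¬s) (yes a) _ _ g _ _ = ⊥-elim (¬s (g a))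
    indicator (no ¬s) (no _) (yes n) _ _ h _ = ⊥-elim (¬s (h n))
    indicator (no _) (no _) (no _) _ _ _ _ = refl

  count-periodic : ∀ {S : ℕ → Set} (S? : ∀ b → Dec (S b)) m →
    (∀ x → S (m + x) → S x) → (∀ x → S x → S (m + x)) → ∀ j → count S? (j * m) ≡ j * count S? m
  count-periodic S? m down up zero = refl
  count-periodic S? m down up (suc j) = begin
    count S? (m + j * m)                          ≡⟨ count-+ S? m (j * m) ⟩
    count S? m + count (λ x → S? (m + x)) (j * m) ≡⟨ cong (count S? m +_) (count-cong _ S? (j * m) (λ b _ → down b) (λ b _ → up b)) ⟩
    count S? m + count S? (j * m)                 ≡⟨ cong (count S? m +_) (count-periodic S? m down up j) ⟩
    count S? m + j * count S? m                   ∎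
    where open ≡-Reasoning

  Multiple : (K : ℕ) .{{_ : NonZero K}} → (ℕ → Set) → ℕ → Set
  Multiple K Q b = (b % K ≡ 0) × Q (b / K)

  Multiple? : (K : ℕ) .{{_ : NonZero K}} {Q : ℕ → Set} → (∀ b → Dec (Q b)) → ∀ b → Dec (Multiple K Q b)
  Multiple? K Q? b = (b % K ≟ 0) ×-dec Q? (b / K)

  count-multiples : (K : ℕ) .{{_ : NonZero K}} {Q : ℕ → Set} (Q? : ∀ b → Dec (Q b)) (M : ℕ) →
    count (Multiple? K Q?) (M * K) ≡ count Q? M
  count-multiples K Q? zero = refl
  count-multiples K@(suc K-1) {Q} Q? (suc M) = begin
    count (Multiple? K Q?) (K + M * K)                                  ≡⟨ count-+ (Multiple? K Q?) K (M * K) ⟩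
    count (Multiple? K Q?) K + count (λ x → Multiple? K Q? (K + x)) (M * K) ≡⟨ cong₂ _+_ first-block later-blocks ⟩
    count Q? 1 + count (λ q → Q? (1 + q)) M                            ≡⟨ sym (count-+ Q? 1 M) ⟩
    count Q? (suc M)                                                    ∎
    where
    open ≡-Reasoning
    -- Below K the only multiple of K is 0.
    first-block : count (Multiple? K Q?) K ≡ count Q? 1
    first-block = begin
      count (Multiple? K Q?) (1 + K-1)                                     ≡⟨ count-+ (Multiple? K Q?) 1 K-1 ⟩
      count (Multiple? K Q?) 1 + count (λ x → Multiple? K Q? (1 + x)) K-1 ≡⟨ cong₂ _+_ zero-case (count-empty _ K-1 no-positive-multiple) ⟩
      count Q? 1 + 0                                                       ≡⟨ +-identityʳ _ ⟩
      count Q? 1                                                           ∎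
      where
      zero-case : count (Multiple? K Q?) 1 ≡ count Q? 1
      zero-case = cong (_+ 0) (⟦⟧-cong (Multiple? K Q? 0) (Q? 0) proj₂ (refl ,_))
      no-positive-multiple : ∀ b → b < K-1 → ¬ Multiple K Q (1 + b)
      no-positive-multiple b b<K-1 (K∣1+b , _) = 1+n≢0 (trans (sym (m<n⇒m%n≡m (s≤s b<K-1))) K∣1+b)
    shift-% : ∀ x → (K + x) % K ≡ x % K
    shift-% x = trans (cong (_% K) (+-comm K x)) ([m+n]%n≡m%n x K)
    shift-/ : ∀ x → (K + x) / K ≡ suc (x / K)
    shift-/ x = trans (+-distrib-/-∣ˡ x (∣-refl {K})) (cong (_+ x / K) (n/n≡1 K))
    later-blocks : count (λ x → Multiple? K Q? (K + x)) (M * K) ≡ count (λ q → Q? (1 + q)) M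
    later-blocks = trans
      (count-cong _ (Multiple? K (λ q → Q? (1 + q))) (M * K)
        (λ b _ (K∣b , Qb) → trans (sym (shift-% b)) K∣b , subst Q (shift-/ b) Qb)
        (λ b _ (K∣b , Qb) → trans (shift-% b) K∣b , subst Q (sym (shift-/ b)) Qb))
      (count-multiples K (λ q → Q? (1 + q)) M)

  hasSize-extend : ∀ {n s} {P : ℕ → Set} → P n → HasSize n P s → HasSize (suc n) P (suc s)
  hasSize-extend {n} {s} {P} Pn (g , g-inj , g-sound , g-complete) = g′ , g′-inj , g′-sound , g′-complete
    where
    g′ : Fin (suc s) → ℕ
    g′ zero = n
    g′ (suc i) = g i
    g′-inj : Injective _≡_ _≡_ g′
    g′-inj {zero} {zero} _ = refl
    g′-inj {zero} {suc j} n≡gj = ⊥-elim (<-irrefl (sym n≡gj) (proj₁ (g-sound j)))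
    g′-inj {suc i} {zero} gi≡n = ⊥-elim (<-irrefl gi≡n (proj₁ (g-sound i)))
    g′-inj {suc i} {suc j} gi≡gj = cong suc (g-inj gi≡gj)
    g′-sound : ∀ i → g′ i < suc n × P (g′ i)
    g′-sound zero = ≤-refl , Pn
    g′-sound (suc i) = m<n⇒m<1+n (proj₁ (g-sound i)) , proj₂ (g-sound i)
    g′-complete : ∀ b → b < suc n → P b → ∃ λ i → g′ i ≡ b
    g′-complete b b<1+n Pb with m≤n⇒m<n∨m≡n (s≤s⁻¹ b<1+n)
    ... | inj₁ b<n = let i , gi≡b = g-complete b b<n Pb in suc i , gi≡b
    ... | inj₂ b≡n = zero , sym b≡n

  hasSize-skip : ∀ {n s} {P : ℕ → Set} → ¬ P n → HasSize n P s → HasSize (suc n) P s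
  hasSize-skip {n} ¬Pn (g , g-inj , g-sound , g-complete) =
    g , g-inj , (λ i → m<n⇒m<1+n (proj₁ (g-sound i)) , proj₂ (g-sound i)) , complete
    where
    complete : ∀ b → b < suc n → _ → ∃ λ i → g i ≡ b
    complete b b<1+n Pb with m≤n⇒m<n∨m≡n (s≤s⁻¹ b<1+n)
    ... | inj₁ b<n = g-complete b b<n Pb
    ... | inj₂ refl = ⊥-elim (¬Pn Pb)

  hasSize-count : ∀ {P : ℕ → Set} (P? : ∀ b → Dec (P b)) n → HasSize n P (count P? n)
  hasSize-count P? zero = (λ ()) , (λ {}) , (λ ()) , (λ _ ())
  hasSize-count P? (suc n) with P? n
  ... | yes Pn = hasSize-extend Pn (hasSize-count P? n)
  ... | no ¬Pn = hasSize-skip ¬Pn (hasSize-count P? n)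

  -- Sizes are unique: two enumerations inject into each other.
  hasSize-≤ : ∀ {n} {P : ℕ → Set} {s s′} → HasSize n P s → HasSize n P s′ → s ≤ s′
  hasSize-≤ {s = s} {s′} (g , g-inj , g-sound , _) (g′ , _ , _ , g′-complete) = injective⇒≤ {f = h} h-inj
    where
    locate : ∀ i → ∃ λ i′ → g′ i′ ≡ g i
    locate i = g′-complete (g i) (proj₁ (g-sound i)) (proj₂ (g-sound i))
    h : Fin s → Fin s′
    h i = proj₁ (locate i)
    h-inj : Injective _≡_ _≡_ h
    h-inj {i} {j} hi≡hj = g-inj (trans (sym (proj₂ (locate i))) (trans (cong g′ hi≡hj) (proj₂ (locate j))))

  hasSize-unique : ∀ {n} {P : ℕ → Set} {s s′} → HasSize n P s → HasSize n P s′ → s ≡ s′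
  hasSize-unique h h′ = ≤-antisym (hasSize-≤ h h′) (hasSize-≤ h′ h)


module DiagonalForm where

  open import Data.Nat as ℕ using (ℕ; zero; suc; NonZero)
  open import Data.Nat.Properties using (anyUpTo?)
  import Data.Nat.Divisibility as ℕ∣
  open import Data.Fin using (Fin; zero; suc)
  open import Data.Integer as ℤ using (ℤ; +_; _+_; _*_; _-_; _^_; 0ℤ; 1ℤ; ∣_∣)
  open import Data.Integer.Properties using (pos-*; +-assoc; *-zeroʳ; *-distribˡ-+)
  open import Data.Integer.DivMod using (_%ℕ_; _/ℕ_; a≡a%ℕn+[a/ℕn]*n; n%ℕd<d)
  open import Data.Integer.Divisibility.Signed using (_∣_; divides; ∣m∣n⇒∣m+n; ∣m∣n⇒∣m-n; ∣n⇒∣m*n; ∣ᵤ⇒∣; ∣⇒∣ᵤ)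
  open import Data.Integer.Tactic.RingSolver using (solve-∀)
  open import Data.Product using (∃; _×_; _,_)
  open import Relation.Nullary using (Dec; yes; no)
  open import Relation.Binary.PropositionalEquality
  open import Defs using (sumFin; diagForm; InA)

  sumFin-cong : ∀ {t} (g h : Fin t → ℤ) → (∀ i → g i ≡ h i) → sumFin g ≡ sumFin h
  sumFin-cong {zero} g h g≗h = refl
  sumFin-cong {suc t} g h g≗h = cong₂ _+_ (g≗h zero) (sumFin-cong (λ i → g (suc i)) (λ i → h (suc i)) (λ i → g≗h (suc i)))

  sumFin-*ˡ : ∀ {t} (z : ℤ) (g : Fin t → ℤ) → sumFin (λ i → z * g i) ≡ z * sumFin g
  sumFin-*ˡ {zero} z g = sym (*-zeroʳ z)
  sumFin-*ˡ {suc t} z g =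
    trans (cong (_+_ (z * g zero)) (sumFin-*ˡ z (λ i → g (suc i)))) (sym (*-distribˡ-+ z (g zero) _))

  sumFin-- : ∀ {t} (g h : Fin t → ℤ) → sumFin g - sumFin h ≡ sumFin (λ i → g i - h i)
  sumFin-- {zero} g h = refl
  sumFin-- {suc t} g h =
    trans (regroup (g zero) (h zero) (sumFin (λ i → g (suc i))) (sumFin (λ i → h (suc i))))
          (cong (_+_ (g zero - h zero)) (sumFin-- (λ i → g (suc i)) (λ i → h (suc i))))
    where
    regroup : ∀ a b c d → (a + c) - (b + d) ≡ (a - b) + (c - d)
    regroup = solve-∀

  sumFin-∣ : ∀ {t} (m : ℤ) (g : Fin t → ℤ) → (∀ i → m ∣ g i) → m ∣ sumFin g
  sumFin-∣ {zero} m g _ = divides 0ℤ refl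
  sumFin-∣ {suc t} m g m∣g = ∣m∣n⇒∣m+n (m∣g zero) (sumFin-∣ m (λ i → g (suc i)) (λ i → m∣g (suc i)))

  pos-^ : ∀ (m n : ℕ) → + (m ℕ.^ n) ≡ (+ m) ^ n
  pos-^ m zero = refl
  pos-^ m (suc n) = trans (pos-* m (m ℕ.^ n)) (cong (+ m *_) (pos-^ m n))

  ^-distrib-* : ∀ (a b : ℤ) k → (a * b) ^ k ≡ a ^ k * b ^ k
  ^-distrib-* a b zero = refl
  ^-distrib-* a b (suc k) = trans (cong (a * b *_) (^-distrib-* a b k)) (interchange a b (a ^ k) (b ^ k))
    where
    interchange : ∀ a b x y → (a * b) * (x * y) ≡ (a * x) * (b * y)
    interchange = solve-∀

  ^-difference : ∀ (a b : ℤ) k → ∃ λ q → a ^ k - b ^ k ≡ q * (a - b)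
  ^-difference a b zero = 0ℤ , refl
  ^-difference a b (suc k) with ^-difference a b k
  ... | q , eq = a * q + b ^ k , trans (split a b (a ^ k) (b ^ k)) (trans (cong (λ z → a * z + (a - b) * b ^ k) eq) (collect a b q (b ^ k)))
    where
    split : ∀ a b x y → a * x - b * y ≡ a * (x - y) + (a - b) * y
    split = solve-∀
    collect : ∀ a b q y → a * (q * (a - b)) + (a - b) * y ≡ (a * q + y) * (a - b)
    collect = solve-∀

  ^-congruence : ∀ {m a b : ℤ} k → m ∣ a - b → m ∣ a ^ k - b ^ k
  ^-congruence {m} {a} {b} k m∣a-b with ^-difference a b k
  ... | q , eq = subst (m ∣_) (sym eq) (∣n⇒∣m*n q m∣a-b)

  binomial-head : ∀ k₀ (X h : ℤ) → ∃ λ Q → (X + h) ^ suc k₀ ≡ X ^ suc k₀ + + suc k₀ * X ^ k₀ * h + h * h * Q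
  binomial-head zero X h = 0ℤ , base X h
    where
    base : ∀ X h → (X + h) * 1ℤ ≡ X * 1ℤ + 1ℤ * 1ℤ * h + h * h * 0ℤ
    base = solve-∀
  binomial-head (suc k₀) X h with binomial-head k₀ X h
  ... | Q , eq = X * Q + + suc k₀ * X ^ k₀ + h * Q , trans (cong ((X + h) *_) eq) (step X h (X ^ k₀) (+ suc k₀) Q)
    where
    step : ∀ X h Xk K Q → (X + h) * (X * Xk + K * Xk * h + h * h * Q)
                         ≡ X * (X * Xk) + (1ℤ + K) * (X * Xk) * h + h * h * (X * Q + K * Xk + h * Q)
    step = solve-∀

  shift : ∀ {t} → (Fin t → ℤ) → Fin t → ℤ → Fin t → ℤ
  shift x zero h zero = x zero + h
  shift x zero h (suc j) = x (suc j)
  shift x (suc i) h zero = x zero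
  shift x (suc i) h (suc j) = shift (λ j → x (suc j)) i h j

  cons : ∀ {t} → ℕ → (Fin t → ℕ) → Fin (suc t) → ℕ
  cons a x zero = a
  cons a x (suc i) = x i

  search : ∀ t m (P : (Fin t → ℕ) → Set) → (∀ x → Dec (P x)) → (∀ x y → (∀ i → x i ≡ y i) → P x → P y) →
    Dec (∃ λ x → (∀ i → x i ℕ.< m) × P x)
  search zero m P P? P-resp with P? (λ ())
  ... | yes Px = yes ((λ ()) , (λ ()) , Px)
  ... | no ¬Px = no λ (x , _ , Px) → ¬Px (P-resp x (λ ()) (λ ()) Px)
  search (suc t) m P P? P-resp with anyUpTo? search-with-head m
    where
    search-with-head : ∀ a → Dec (∃ λ x → (∀ i → x i ℕ.< m) × P (cons a x))
    search-with-head a = search t m (λ x → P (cons a x)) (λ x → P? (cons a x))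
      (λ x y x≗y → P-resp (cons a x) (cons a y) λ { zero → refl ; (suc i) → x≗y i })
  ... | yes (a , a<m , x , x<m , Px) = yes (cons a x , (λ { zero → a<m ; (suc i) → x<m i }) , Px)
  ... | no ¬found = no λ (x , x<m , Px) →
    ¬found (x zero , x<m zero , (λ i → x (suc i)) , (λ i → x<m (suc i)) , P-resp x _ (λ { zero → refl ; (suc i) → refl }) Px)

  module _ {t : ℕ} (c : Fin t → ℤ) (k : ℕ) where

    private
      F : (Fin t → ℤ) → ℤ
      F = diagForm c k

    form-cong : ∀ x y → (∀ i → x i ≡ y i) → F x ≡ F y
    form-cong x y x≗y = sumFin-cong _ _ (λ i → cong (λ z → c i * z ^ k) (x≗y i))

    form-scale : ∀ (z : ℤ) x → F (λ i → z * x i) ≡ z ^ k * F x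
    form-scale z x =
      trans (sumFin-cong _ _ (λ i → trans (cong (c i *_) (^-distrib-* z (x i) k)) (swap (c i) (z ^ k) (x i ^ k))))
            (sumFin-*ˡ (z ^ k) (λ i → c i * x i ^ k))
      where
      swap : ∀ c a b → c * (a * b) ≡ a * (c * b)
      swap = solve-∀

    form-congruence : ∀ (m : ℤ) x y → (∀ i → m ∣ x i - y i) → m ∣ F x - F y
    form-congruence m x y m∣x-y =
      subst (m ∣_) (sym (sumFin-- (λ i → c i * x i ^ k) (λ i → c i * y i ^ k)))
        (sumFin-∣ m _ (λ i → subst (m ∣_) (distrib (c i) (x i ^ k) (y i ^ k))
                                    (∣n⇒∣m*n (c i) (^-congruence k (m∣x-y i)))))
      where
      distrib : ∀ a b c → a * (b - c) ≡ a * b - a * c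
      distrib = solve-∀

    form-shift : ∀ x i h → F (shift x i h) ≡ F x + c i * ((x i + h) ^ k - x i ^ k)
    form-shift = go c
      where
      -- generalised over the coefficients, for the induction on t
      go : ∀ {t} (c : Fin t → ℤ) x i h → diagForm c k (shift x i h) ≡ diagForm c k x + c i * ((x i + h) ^ k - x i ^ k)
      go c x zero h = regroup (c zero) ((x zero + h) ^ k) (x zero ^ k) (sumFin (λ i → c (suc i) * x (suc i) ^ k))
        where
        regroup : ∀ c a b s → c * a + s ≡ (c * b + s) + c * (a - b)
        regroup = solve-∀
      go c x (suc i) h =
        trans (cong (_+_ (c zero * x zero ^ k)) (go (λ j → c (suc j)) (λ j → x (suc j)) i h))
              (sym (+-assoc (c zero * x zero ^ k) _ _))

    SolvesOver : ℕ → ℕ → (Fin t → ℕ) → Set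
    SolvesOver m a y = m ℕ∣.∣ ∣ F (λ i → + y i) - + a ∣

    SolvesOver-resp : ∀ m a x y → (∀ i → x i ≡ y i) → SolvesOver m a x → SolvesOver m a y
    SolvesOver-resp m a x y x≗y = subst (λ z → m ℕ∣.∣ ∣ z - + a ∣) (form-cong _ _ (λ i → cong +_ (x≗y i)))

    reduce-solution : ∀ m .{{_ : NonZero m}} a x → m ℕ∣.∣ ∣ F x - + a ∣ → SolvesOver m a (λ i → x i %ℕ m)
    reduce-solution m a x m∣ = ∣⇒∣ᵤ (subst (+ m ∣_) (cancel (F x) (F x′) (+ a))
      (∣m∣n⇒∣m-n (∣ᵤ⇒∣ {+ m} {F x - + a} m∣) (form-congruence (+ m) x x′ m∣x-x′)))
      where
      x′ : Fin t → ℤ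
      x′ i = + (x i %ℕ m)
      cancel : ∀ u v w → (u - w) - (u - v) ≡ v - w
      cancel = solve-∀
      cancel′ : ∀ u v → (u + v) - u ≡ v
      cancel′ = solve-∀
      m∣x-x′ : ∀ i → + m ∣ x i - x′ i
      m∣x-x′ i = divides (x i /ℕ m) (trans (cong (_- x′ i) (a≡a%ℕn+[a/ℕn]*n (x i) m)) (cancel′ (x′ i) (x i /ℕ m * + m)))

    -- Membership in A_m is decidable, since it suffices to search solutions with coordinates in [0, m).
    InA? : ∀ m .{{_ : NonZero m}} a → Dec (InA c k m a)
    InA? m a with a ℕ.<? m | search t m (SolvesOver m a) (λ y → m ℕ∣.∣? ∣ F (λ i → + y i) - + a ∣) (SolvesOver-resp m a)
    ... | no a≮m | _ = no λ (a<m , _) → a≮m a<m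
    ... | yes a<m | yes (y , _ , m∣) = yes (a<m , (λ i → + y i) , m∣)
    ... | yes a<m | no ¬small =
      no λ (_ , x , m∣) → ¬small ((λ i → x i %ℕ m) , (λ i → n%ℕd<d (x i) m) , reduce-solution m a x m∣)

  form-shift-expansion : ∀ {t} (c : Fin t → ℤ) k .{{_ : NonZero k}} x i h → ∃ λ Q →
    diagForm c k (shift x i h) ≡ diagForm c k x + c i * + k * x i ^ (k ℕ.∸ 1) * h + h * h * Q
  form-shift-expansion c k@(suc k₀) x i h with binomial-head k₀ (x i) h
  ... | Q , binomial = c i * Q , (begin
    diagForm c k (shift x i h)                                    ≡⟨ form-shift c k x i h ⟩
    diagForm c k x + c i * ((x i + h) ^ k - x i ^ k)              ≡⟨ cong (λ y → diagForm c k x + c i * (y - x i ^ k)) binomial ⟩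
    diagForm c k x + c i * ((x i ^ k + + k * x i ^ k₀ * h + h * h * Q) - x i ^ k)
                                                                  ≡⟨ expand (diagForm c k x) (c i) (x i ^ k) (x i ^ k₀) (+ k) h Q ⟩
    diagForm c k x + c i * + k * x i ^ k₀ * h + h * h * (c i * Q) ∎)
    where
    open ≡-Reasoning
    expand : ∀ f c X X₀ K h Q → f + c * ((X + K * X₀ * h + h * h * Q) - X) ≡ f + c * K * X₀ * h + h * h * (c * Q)
    expand = solve-∀


module Residues where

  open import Data.Nat as ℕ using (ℕ; NonZero; _%_; _/_)
  open import Data.Nat.Properties using (≤-trans; +-monoˡ-<; *-monoˡ-≤)
  open import Data.Nat.DivMod using (m%n<n; m≡m%n+[m/n]*n; [m+kn]%n≡m%n; m<n⇒m%n≡m; m<n*o⇒m/o<n)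
  open import Data.Fin using (Fin)
  open import Data.Integer as ℤ using (ℤ; +_; _+_; _*_; _-_)
  open import Data.Integer.Properties using (pos-*; pos-+)
  open import Data.Integer.Divisibility.Signed using (_∣_; divides; ∣-refl; ∣-trans; ∣m∣n⇒∣m+n; ∣n⇒∣m*n; ∣ᵤ⇒∣; ∣⇒∣ᵤ)
  open import Data.Integer.Tactic.RingSolver using (solve-∀)
  open import Data.Product using (_×_; _,_; proj₁)
  open import Relation.Nullary using (Dec)
  open import Relation.Nullary.Decidable using (_×-dec_; map′)
  open import Relation.Binary.PropositionalEquality
  open import Defs using (diagForm; InA; InAsub)
  open DiagonalForm using (InA?)

  digit-bound : ∀ {a j m q} → a ℕ.< m → j ℕ.< q → a ℕ.+ j ℕ.* m ℕ.< q ℕ.* m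
  digit-bound {a} {j} {m} a<m j<q = ≤-trans (+-monoˡ-< (j ℕ.* m) a<m) (*-monoˡ-≤ m j<q)

  module _ {t : ℕ} (c : Fin t → ℤ) (k : ℕ) where

    private
      F : (Fin t → ℤ) → ℤ
      F = diagForm c k

    -- A solution modulo q m is one modulo m, so b ∈ A_{qm} implies (b mod m) ∈ A_m.
    InA-reduce : ∀ q m .{{_ : NonZero m}} b → InA c k (q ℕ.* m) b → InA c k m (b % m)
    InA-reduce q m b (_ , x , qm∣) = m%n<n b m , x , ∣⇒∣ᵤ (subst (+ m ∣_) rewrite-b m∣F-b%m)
      where
      m∣F-b : + m ∣ F x - + b
      m∣F-b = ∣-trans (divides (+ q) (pos-* q m)) (∣ᵤ⇒∣ {+ (q ℕ.* m)} {F x - + b} qm∣)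
      m∣F-b%m : + m ∣ (F x - + b) + + (b / m) * + m
      m∣F-b%m = ∣m∣n⇒∣m+n m∣F-b (∣n⇒∣m*n (+ (b / m)) ∣-refl)
      +b : + b ≡ + (b % m) + + (b / m) * + m
      +b = trans (cong +_ (m≡m%n+[m/n]*n b m)) (trans (pos-+ (b % m) (b / m ℕ.* m)) (cong (_+_ (+ (b % m))) (pos-* (b / m) m)))
      regroup : ∀ f r q m → (f - (r + q * m)) + q * m ≡ f - r
      regroup = solve-∀
      rewrite-b : (F x - + b) + + (b / m) * + m ≡ F x - + (b % m)
      rewrite-b = trans (cong (λ z → (F x - z) + + (b / m) * + m) +b) (regroup (F x) (+ (b % m)) (+ (b / m)) (+ m))

    InAsub⇒ : ∀ m .{{_ : NonZero m}} q b → InAsub c k m q b → b ℕ.< q ℕ.* m × InA c k m (b % m)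
    InAsub⇒ m q b (a , a∈A , j , j<q , refl) =
      digit-bound (proj₁ a∈A) j<q , subst (InA c k m) (sym (trans ([m+kn]%n≡m%n a j m) (m<n⇒m%n≡m (proj₁ a∈A)))) a∈A

    InAsub⇐ : ∀ m .{{_ : NonZero m}} q b → b ℕ.< q ℕ.* m → InA c k m (b % m) → InAsub c k m q b
    InAsub⇐ m q b b<qm b%m∈A = b % m , b%m∈A , b / m , m<n*o⇒m/o<n b<qm , m≡m%n+[m/n]*n b m

    InAsub? : ∀ m .{{_ : NonZero m}} q b → Dec (InAsub c k m q b)
    InAsub? m q b = map′ (λ (b<qm , b%m∈A) → InAsub⇐ m q b b<qm b%m∈A) (InAsub⇒ m q b)
                         ((b ℕ.<? q ℕ.* m) ×-dec InA? c k m (b % m))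


module PrimeFacts where

  open import Data.Nat as ℕ using (ℕ; zero; suc; NonZero; _^_; z≤n)
  open import Data.Nat.Properties as ℕₚ using (≤-trans; ≤-refl; +-mono-≤; *-monoˡ-≤; m<m*n; m≤m*n; m^n>0)
  open import Data.Nat.Divisibility using (_∣_; _∣?_; divides; ∣1⇒≡1)
  open import Data.Nat.Primality using (Prime; prime⇒nonZero; prime⇒nonTrivial; prime⇒irreducible; euclidsLemma)
  open import Data.Nat.Coprimality using (Coprime; coprime-Bézout)
  open import Data.Nat.GCD using (module Bézout)
  open import Data.Nat.Induction using (<-wellFounded)
  open import Induction.WellFounded using (Acc; acc)
  open import Data.Integer as ℤ using (+_; -[1+_]; _+_; _*_; _-_; -_; 1ℤ; ∣_∣)
  open import Data.Integer.Properties using (pos-*)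
  open import Data.Integer.Tactic.RingSolver using (solve-∀)
  open import Data.Nat.Tactic.RingSolver using () renaming (solve-∀ to ℕ-solve-∀)
  open import Data.Product using (∃₂; _×_; _,_)
  open import Data.Sum using (inj₁; inj₂)
  open import Data.Empty using (⊥-elim)
  open import Relation.Nullary using (¬_; yes; no)
  open import Relation.Binary.PropositionalEquality

  module _ (p : ℕ) (p-prime : Prime p) where

    private
      instance
        p≢0 : NonZero p
        p≢0 = prime⇒nonZero p-prime
        p-nontrivial : ℕ.NonTrivial p
        p-nontrivial = prime⇒nonTrivial p-prime

      1<p : 1 ℕ.< p
      1<p = ℕ.nonTrivial⇒n>1 p

    1+v≤p^v : ∀ v → suc v ℕ.≤ p ^ v
    1+v≤p^v zero = ≤-refl
    1+v≤p^v (suc v) = ≤-trans (+-mono-≤ (m^n>0 p v) (1+v≤p^v v)) (double≤p* (p ^ v))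
      where
      double≤p* : ∀ n → n ℕ.+ n ℕ.≤ p ℕ.* n
      double≤p* n = subst (ℕ._≤ p ℕ.* n) (cong (n ℕ.+_) (ℕₚ.+-identityʳ n)) (*-monoˡ-≤ n 1<p)

    v+v≤p^v : ∀ v → v ℕ.+ v ℕ.≤ p ^ v
    v+v≤p^v zero = z≤n
    v+v≤p^v (suc v) = ≤-trans (+-mono-≤ (1+v≤p^v v) (1+v≤p^v v))
      (subst (ℕ._≤ p ℕ.* p ^ v) (cong (p ^ v ℕ.+_) (ℕₚ.+-identityʳ (p ^ v))) (*-monoˡ-≤ (p ^ v) 1<p))

    p-adic-split : ∀ n .{{_ : NonZero n}} → ∃₂ λ v n′ → n ≡ p ^ v ℕ.* n′ × ¬ p ∣ n′ × v ℕ.+ v ℕ.≤ n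
    p-adic-split n = split n (<-wellFounded n)
      where
      split : ∀ n .{{_ : NonZero n}} → Acc ℕ._<_ n → ∃₂ λ v n′ → n ≡ p ^ v ℕ.* n′ × ¬ p ∣ n′ × v ℕ.+ v ℕ.≤ n
      split n (acc smaller) with p ∣? n
      ... | no p∤n = 0 , n , sym (ℕₚ.+-identityʳ n) , p∤n , z≤n
      ... | yes (divides zero n≡0) = ⊥-elim (ℕ.≢-nonZero⁻¹ n n≡0)
      ... | yes (divides q@(suc _) n≡q*p) with split q (smaller (subst (q ℕ.<_) (sym n≡q*p) (m<m*n q p 1<p)))
      ...   | v , n′ , q≡ , p∤n′ , _ = suc v , n′ , n≡ , p∤n′ , bound
        where
        n≡ : n ≡ p ^ suc v ℕ.* n′
        n≡ = trans n≡q*p (trans (cong (ℕ._* p) q≡) (rotate (p ^ v) n′ p))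
          where
          rotate : ∀ a b p → a ℕ.* b ℕ.* p ≡ p ℕ.* a ℕ.* b
          rotate = ℕ-solve-∀
        n′≢0 : NonZero n′
        n′≢0 = ℕ.≢-nonZero λ n′≡0 → p∤n′ (divides 0 n′≡0)
        bound : suc v ℕ.+ suc v ℕ.≤ n
        bound = ≤-trans (v+v≤p^v (suc v)) (subst (p ^ suc v ℕ.≤_) (sym n≡) (m≤m*n (p ^ suc v) n′ {{n′≢0}}))

    ∤-* : ∀ {a b} → ¬ p ∣ a → ¬ p ∣ b → ¬ p ∣ a ℕ.* b
    ∤-* {a} {b} p∤a p∤b p∣ab with euclidsLemma a b p-prime p∣ab
    ... | inj₁ p∣a = p∤a p∣a
    ... | inj₂ p∣b = p∤b p∣b

    ∤-^ : ∀ {a} n → ¬ p ∣ a → ¬ p ∣ a ^ n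
    ∤-^ zero p∤a p∣1 = ℕ.nonTrivial⇒≢1 (∣1⇒≡1 p∣1)
    ∤-^ (suc n) p∤a = ∤-* p∤a (∤-^ n p∤a)

    ∤⇒coprime : ∀ {n} → ¬ p ∣ n → Coprime p n
    ∤⇒coprime p∤n (d∣p , d∣n) with prime⇒irreducible p-prime d∣p
    ... | inj₁ d≡1 = d≡1
    ... | inj₂ refl = ⊥-elim (p∤n d∣n)

    inverse-mod-p-ℕ : ∀ n → ¬ p ∣ n → ∃₂ λ U z → + n * U - 1ℤ ≡ z * + p
    inverse-mod-p-ℕ n p∤n with coprime-Bézout (∤⇒coprime p∤n)
    ... | Bézout.+- x y 1+yn≡xp = - + y , - + x , trans (negate (+ n) (+ y)) (trans (cong -_ (lift 1+yn≡xp)) (neg-* (+ x) (+ p)))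
      where
      negate : ∀ n y → n * (- y) - 1ℤ ≡ - (1ℤ + y * n)
      negate = solve-∀
      neg-* : ∀ x p → - (x * p) ≡ (- x) * p
      neg-* = solve-∀
      lift : 1 ℕ.+ y ℕ.* n ≡ x ℕ.* p → 1ℤ + + y * + n ≡ + x * + p
      lift eq = trans (cong (_+_ 1ℤ) (sym (pos-* y n))) (trans (cong +_ eq) (pos-* x p))
    ... | Bézout.-+ x y 1+xp≡yn = + y , + x , trans (comm (+ n) (+ y)) (trans (cong (_- 1ℤ) (sym (lift 1+xp≡yn))) (cancel (+ x * + p)))
      where
      comm : ∀ n y → n * y - 1ℤ ≡ y * n - 1ℤ
      comm = solve-∀
      cancel : ∀ a → (1ℤ + a) - 1ℤ ≡ a
      cancel = solve-∀
      lift : 1 ℕ.+ x ℕ.* p ≡ y ℕ.* n → 1ℤ + + x * + p ≡ + y * + n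
      lift eq = trans (cong (_+_ 1ℤ) (sym (pos-* x p))) (trans (cong +_ eq) (pos-* y n))

    inverse-mod-p : ∀ u → ¬ p ∣ ∣ u ∣ → ∃₂ λ U z → u * U - 1ℤ ≡ z * + p
    inverse-mod-p (+ n) p∤n = inverse-mod-p-ℕ n p∤n
    inverse-mod-p -[1+ n ] p∤n with inverse-mod-p (+ suc n) p∤n
    ... | U , z , eq = - U , z , trans (neg-neg (+ suc n) U) eq
      where
      neg-neg : ∀ a U → (- a) * (- U) - 1ℤ ≡ a * U - 1ℤ
      neg-neg = solve-∀


module Scaling where

  open import Data.Nat as ℕ using (ℕ; zero; suc; NonZero; _^_)
  open import Data.Nat.Properties as ℕₚ using (m^n≢0; *-monoʳ-<; *-cancelˡ-<; *-cancelˡ-≡; ^-distribˡ-+-*)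
  import Data.Nat.Divisibility as ℕ∣
  open import Data.Nat.Tactic.RingSolver using () renaming (solve-∀ to ℕ-solve-∀)
  open import Data.Fin using (Fin)
  open import Data.Integer as ℤ using (ℤ; +_; _+_; _*_; _-_)
  open import Data.Integer.Properties using (pos-*; *-identityʳ; *-assoc; *-comm)
  open import Data.Integer.Divisibility.Signed using (_∣_; divides; ∣-trans; ∣m∣n⇒∣m+n; *-monoʳ-∣; *-cancelʳ-∣; *-cancelˡ-∣; ∣ᵤ⇒∣; ∣⇒∣ᵤ)
  open import Data.Integer.Tactic.RingSolver using (solve-∀)
  open import Data.Product using (∃; _,_; proj₁; proj₂)
  open import Relation.Binary.PropositionalEquality
  open import Defs using (diagForm; InA; InAsub; IsExponent)
  open DiagonalForm using (form-scale; pos-^)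

  -- Multiplying solutions by z multiplies values by Z = z^k:
  -- b ∈ A_m implies Z b ∈ A_{Z m}, and likewise for A_{qm}(m).
  module _ {t : ℕ} (c : Fin t → ℤ) (k z : ℕ) .{{_ : NonZero z}} where

    private
      F : (Fin t → ℤ) → ℤ
      F = diagForm c k
      Z : ℕ
      Z = z ^ k
      instance
        Z≢0 : NonZero Z
        Z≢0 = m^n≢0 z k

    InA-scale : ∀ m b → InA c k m b → InA c k (Z ℕ.* m) (Z ℕ.* b)
    InA-scale m b (b<m , x , m∣) = *-monoʳ-< Z b<m , (λ i → + z * x i) , ∣⇒∣ᵤ (subst₂ _∣_ (sym (pos-* Z m)) scaled Zm∣)
      where
      Zm∣ : + Z * + m ∣ + Z * (F x - + b)
      Zm∣ = *-monoʳ-∣ (+ Z) (∣ᵤ⇒∣ {+ m} {F x - + b} m∣)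
      distrib : ∀ a b c → a * (b - c) ≡ a * b - a * c
      distrib = solve-∀
      scaled : + Z * (F x - + b) ≡ F (λ i → + z * x i) - + (Z ℕ.* b)
      scaled = trans (distrib (+ Z) (F x) (+ b))
                     (cong₂ _-_ (trans (cong (_* F x) (pos-^ z k)) (sym (form-scale c k (+ z) x))) (sym (pos-* Z b)))

    InAsub-scale : ∀ m q b → InAsub c k m q b → InAsub c k (Z ℕ.* m) q (Z ℕ.* b)
    InAsub-scale m q b (a , a∈A , j , j<q , refl) = Z ℕ.* a , InA-scale m a a∈A , j , j<q , distrib Z a j m
      where
      distrib : ∀ Z a j m → Z ℕ.* (a ℕ.+ j ℕ.* m) ≡ Z ℕ.* a ℕ.+ j ℕ.* (Z ℕ.* m)
      distrib = ℕ-solve-∀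

  -- When some exponent e of p divides k, values of f divisible by K = p^k are K times
  -- values of f; this makes the scaling by K reversible.
  module _ {t : ℕ} (c : Fin t → ℤ) (k p : ℕ) .{{_ : NonZero p}} (e : ℕ)
           (e-exponent : IsExponent c k p e) (e∣k : e ℕ∣.∣ k) where

    private
      F : (Fin t → ℤ) → ℤ
      F = diagForm c k
      K : ℕ
      K = p ^ k
      instance
        K≢0 : NonZero K
        K≢0 = m^n≢0 p k
        pe≢0 : NonZero (p ^ e)
        pe≢0 = m^n≢0 p e

    exponent-power : ∀ s x → + (p ^ (s ℕ.* e)) ∣ F x → ∃ λ y → F y * + (p ^ (s ℕ.* e)) ≡ F x
    exponent-power zero x _ = x , *-identityʳ (F x)
    exponent-power (suc s) x ∣Fx = step (e-exponent x (∣⇒∣ᵤ (∣-trans (divides pse split) ∣Fx)))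
      where
      pse pe : ℤ
      pse = + (p ^ (s ℕ.* e))
      pe = + (p ^ e)
      split : + (p ^ (suc s ℕ.* e)) ≡ pse * pe
      split = trans (cong +_ (trans (^-distribˡ-+-* p e (s ℕ.* e)) (ℕₚ.*-comm (p ^ e) _))) (pos-* (p ^ (s ℕ.* e)) (p ^ e))
      step : (∃ λ y₁ → F y₁ * pe ≡ F x) → ∃ λ y → F y * + (p ^ (suc s ℕ.* e)) ≡ F x
      step (y₁ , Fy₁*pe≡Fx) with exponent-power s y₁ (*-cancelʳ-∣ pe {pse} {F y₁} (subst₂ _∣_ split (sym Fy₁*pe≡Fx) ∣Fx))
      ... | y , Fy*pse≡Fy₁ = y , (begin
        F y * + (p ^ (suc s ℕ.* e)) ≡⟨ cong (F y *_) split ⟩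
        F y * (pse * pe)            ≡⟨ sym (*-assoc (F y) pse pe) ⟩
        F y * pse * pe              ≡⟨ cong (_* pe) Fy*pse≡Fy₁ ⟩
        F y₁ * pe                   ≡⟨ Fy₁*pe≡Fx ⟩
        F x                         ∎)
        where open ≡-Reasoning

    power-quotient : ∀ x → + K ∣ F x → ∃ λ y → F y * + K ≡ F x
    power-quotient x K∣Fx = subst (λ n → ∃ λ y → F y * + (p ^ n) ≡ F x) (sym k≡se)
                                  (exponent-power s x (subst (λ n → + (p ^ n) ∣ F x) k≡se K∣Fx))
      where
      s : ℕ
      s = ℕ∣._∣_.quotient e∣k
      k≡se : k ≡ s ℕ.* e
      k≡se = ℕ∣._∣_.equality e∣k

    InA-unscale : ∀ m b → InA c k (K ℕ.* m) (K ℕ.* b) → InA c k m b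
    InA-unscale m b (Kb<Km , x , Km∣) = *-cancelˡ-< K b m Kb<Km , y , ∣⇒∣ᵤ (*-cancelˡ-∣ (+ K) (subst₂ _∣_ (pos-* K m) Fx-Kb≡ Km∣ₛ))
      where
      Km∣ₛ : + (K ℕ.* m) ∣ F x - + (K ℕ.* b)
      Km∣ₛ = ∣ᵤ⇒∣ {+ (K ℕ.* m)} {F x - + (K ℕ.* b)} Km∣
      add-back : ∀ f a → (f - a) + a ≡ f
      add-back = solve-∀
      K∣Fx : + K ∣ F x
      K∣Fx = subst (+ K ∣_) (add-back (F x) (+ (K ℕ.* b)))
                   (∣m∣n⇒∣m+n (∣-trans (divides (+ m) (trans (pos-* K m) (*-comm (+ K) (+ m)))) Km∣ₛ)
                              (divides (+ b) (trans (pos-* K b) (*-comm (+ K) (+ b)))))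
      y : Fin t → ℤ
      y = proj₁ (power-quotient x K∣Fx)
      Fy*K≡Fx : F y * + K ≡ F x
      Fy*K≡Fx = proj₂ (power-quotient x K∣Fx)
      factor : ∀ f K b → f * K - K * b ≡ K * (f - b)
      factor = solve-∀
      Fx-Kb≡ : F x - + (K ℕ.* b) ≡ + K * (F y - + b)
      Fx-Kb≡ = trans (cong₂ _-_ (sym Fy*K≡Fx) (pos-* K b)) (factor (F y) (+ K) (+ b))

    InAsub-unscale : ∀ m q b → InAsub c k (K ℕ.* m) q (K ℕ.* b) → InAsub c k m q b
    InAsub-unscale m q b (a′ , a′∈A , j , j<q , Kb≡a′+jKm) = a , InA-unscale m a (subst (InA c k (K ℕ.* m)) a′≡Ka a′∈A) , j , j<q ,
        *-cancelˡ-≡ b (a ℕ.+ j ℕ.* m) K (trans Kb≡a′+jKm (trans (cong (ℕ._+ j ℕ.* (K ℕ.* m)) a′≡Ka) (collect K a j m)))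
      where
      K∣a′ : K ℕ∣.∣ a′
      K∣a′ = ℕ∣.∣m+n∣m⇒∣n (subst (K ℕ∣.∣_) (trans Kb≡a′+jKm (ℕₚ.+-comm a′ _)) (ℕ∣.m∣m*n b))
                           (ℕ∣.∣n⇒∣m*n j (ℕ∣.m∣m*n m))
      a : ℕ
      a = ℕ∣._∣_.quotient K∣a′
      a′≡Ka : a′ ≡ K ℕ.* a
      a′≡Ka = trans (ℕ∣._∣_.equality K∣a′) (ℕₚ.*-comm a K)
      collect : ∀ K a j m → K ℕ.* a ℕ.+ j ℕ.* (K ℕ.* m) ≡ K ℕ.* (a ℕ.+ j ℕ.* m)
      collect = ℕ-solve-∀


module Hensel where

  open import Data.Nat as ℕ using (ℕ; suc; NonZero; _≤_; _∸_)
  open import Data.Nat.Properties as ℕₚ using (≤-trans; m≤m+n; m+[n∸m]≡n)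
  import Data.Nat.Divisibility as ℕ∣
  open import Data.Nat.Primality using (Prime; prime⇒nonZero)
  open import Data.Nat.Tactic.RingSolver using () renaming (solve-∀ to ℕ-solve-∀)
  open import Data.Fin using (Fin)
  open import Data.Fin.Properties using (all?; ¬∀⟶∃¬)
  open import Data.Integer as ℤ using (ℤ; +_; _+_; _*_; _-_; _^_; 1ℤ; ∣_∣)
  open import Data.Integer.Properties using (pos-*; pos-+; abs-*; ^-distribˡ-+-*; *-comm)
  open import Data.Integer.Divisibility using () renaming (_∣_ to _∣ᵤ_)
  open import Data.Integer.Divisibility.Signed using (_∣_; divides; quotient; ∣-trans; ∣m∣n⇒∣m+n; ∣m∣n⇒∣m-n; ∣n⇒∣m*n; ∣ᵤ⇒∣; ∣⇒∣ᵤ)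
  open import Data.Integer.Tactic.RingSolver using (solve-∀)
  open import Data.Product using (∃; ∃₂; _×_; _,_; proj₁; proj₂)
  open import Data.Empty using (⊥-elim)
  open import Relation.Nullary using (¬_; Dec; yes; no)
  open import Relation.Binary.PropositionalEquality
  open import Defs using (diagForm; InA; InAsub)
  open DiagonalForm using (pos-^; form-cong; form-scale; shift; form-shift-expansion)
  open PrimeFacts using (p-adic-split; ∤-*; ∤-^; inverse-mod-p)
  open Residues using (digit-bound)

  abs-^ : ∀ (X : ℤ) n → ∣ X ^ n ∣ ≡ ∣ X ∣ ℕ.^ n
  abs-^ X ℕ.zero = refl
  abs-^ X (suc n) = trans (abs-* X (X ^ n)) (cong (∣ X ∣ ℕ.*_) (abs-^ X n))

  ^-∣ : ∀ (P : ℤ) {m n} → m ≤ n → P ^ m ∣ P ^ n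
  ^-∣ P {m} {n} m≤n = divides (P ^ (n ∸ m)) (trans (cong (P ^_) (sym (m+[n∸m]≡n m≤n)))
                                                  (trans (^-distribˡ-+-* P m (n ∸ m)) (*-comm (P ^ m) _)))

  halving : ∀ {v k M} → v ℕ.+ v ≤ k → k ℕ.+ 1 ≤ M → v ℕ.+ (M ∸ v) ≡ M × suc M ≤ (M ∸ v) ℕ.+ (M ∸ v)
  halving {v} {k} {M} v+v≤k k+1≤M = v+s≡M , ℕₚ.+-cancelˡ-≤ (v ℕ.+ v) (suc M) (s ℕ.+ s) (begin
    (v ℕ.+ v) ℕ.+ suc M     ≤⟨ ℕₚ.+-monoˡ-≤ (suc M) v+v≤k ⟩
    k ℕ.+ suc M             ≡⟨ swap k M ⟩
    (k ℕ.+ 1) ℕ.+ M         ≤⟨ ℕₚ.+-monoˡ-≤ M k+1≤M ⟩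
    M ℕ.+ M                 ≡⟨ cong₂ ℕ._+_ (sym v+s≡M) (sym v+s≡M) ⟩
    (v ℕ.+ s) ℕ.+ (v ℕ.+ s) ≡⟨ interchange v s ⟩
    (v ℕ.+ v) ℕ.+ (s ℕ.+ s) ∎)
    where
    open ℕₚ.≤-Reasoning
    s = M ∸ v
    v+s≡M : v ℕ.+ s ≡ M
    v+s≡M = m+[n∸m]≡n (≤-trans (m≤m+n v v) (≤-trans v+v≤k (≤-trans (m≤m+n k 1) k+1≤M)))
    swap : ∀ k M → k ℕ.+ suc M ≡ (k ℕ.+ 1) ℕ.+ M
    swap = ℕ-solve-∀
    interchange : ∀ v s → (v ℕ.+ s) ℕ.+ (v ℕ.+ s) ≡ (v ℕ.+ v) ℕ.+ (s ℕ.+ s)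
    interchange = ℕ-solve-∀

  module _ {t : ℕ} (c : Fin t → ℤ) (k p : ℕ) .{{_ : NonZero k}} (p-prime : Prime p)
           (c-units : ∀ i → ¬ + p ∣ᵤ c i) where

    private
      F : (Fin t → ℤ) → ℤ
      F = diagForm c k
      P : ℤ
      P = + p
      instance
        p≢0 : NonZero p
        p≢0 = prime⇒nonZero p-prime

    non-unit-solution : ∀ M → k ≤ M → ∀ x (a : ℤ) → P ^ M ∣ F x - a → (∀ i → p ℕ∣.∣ ∣ x i ∣) → P ^ k ∣ a
    non-unit-solution M k≤M x a P^M∣ p∣x = subst (P ^ k ∣_) (cancel (F x) a) (∣m∣n⇒∣m-n P^k∣Fx (∣-trans (^-∣ P k≤M) P^M∣))
      where
      y : Fin t → ℤ
      y i = quotient (∣ᵤ⇒∣ {P} {x i} (p∣x i))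
      P^k∣Fx : P ^ k ∣ F x
      P^k∣Fx = divides (F y) (trans (form-cong c k x (λ i → P * y i) (λ i → trans (_∣_.equality (∣ᵤ⇒∣ {P} {x i} (p∣x i))) (*-comm (y i) P)))
                                    (trans (form-scale c k P y) (*-comm (P ^ k) (F y))))
      cancel : ∀ f a → f - (f - a) ≡ a
      cancel = solve-∀

    -- Moving coordinate i by p^s w changes f by p^(v+s) u w modulo p^(2s), where k = p^v k′
    -- and u = c_i k′ x_i^(k-1) (the derivative of the i-th term divided by p^v).
    shift-change : ∀ v k′ → k ≡ p ℕ.^ v ℕ.* k′ → ∀ x i s w → ∃ λ R →
      F (shift x i (P ^ s * w)) ≡ F x + P ^ (v ℕ.+ s) * (c i * + k′ * x i ^ (k ∸ 1) * w) + P ^ (s ℕ.+ s) * R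
    shift-change v k′ k≡ x i s w = w * w * Q , (begin
      F (shift x i (P ^ s * w))                                              ≡⟨ expansion ⟩
      F x + c i * + k * X′ * (P ^ s * w) + (P ^ s * w) * (P ^ s * w) * Q      ≡⟨ cong (λ K → F x + c i * K * X′ * (P ^ s * w) + (P ^ s * w) * (P ^ s * w) * Q) +k≡ ⟩
      F x + c i * (P ^ v * + k′) * X′ * (P ^ s * w) + (P ^ s * w) * (P ^ s * w) * Q
                                                                             ≡⟨ regroup (F x) (c i) (P ^ v) (+ k′) X′ (P ^ s) w Q ⟩
      F x + P ^ v * P ^ s * (c i * + k′ * X′ * w) + P ^ s * P ^ s * (w * w * Q) ≡⟨ cong₂ (λ A B → F x + A * (c i * + k′ * X′ * w) + B * (w * w * Q))
                                                                                        (sym (^-distribˡ-+-* P v s)) (sym (^-distribˡ-+-* P s s)) ⟩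
      F x + P ^ (v ℕ.+ s) * (c i * + k′ * X′ * w) + P ^ (s ℕ.+ s) * (w * w * Q) ∎)
      where
      open ≡-Reasoning
      X′ Q : ℤ
      X′ = x i ^ (k ∸ 1)
      Q = proj₁ (form-shift-expansion c k x i (P ^ s * w))
      expansion : F (shift x i (P ^ s * w)) ≡ F x + c i * + k * X′ * (P ^ s * w) + (P ^ s * w) * (P ^ s * w) * Q
      expansion = proj₂ (form-shift-expansion c k x i (P ^ s * w))
      +k≡ : + k ≡ P ^ v * + k′
      +k≡ = trans (cong +_ k≡) (trans (pos-* (p ℕ.^ v) k′) (cong (_* + k′) (pos-^ p v)))
      regroup : ∀ f c Pv k′ X Ps w Q → f + c * (Pv * k′) * X * (Ps * w) + (Ps * w) * (Ps * w) * Q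
                                      ≡ f + Pv * Ps * (c * k′ * X * w) + Ps * Ps * (w * w * Q)
      regroup = solve-∀

    unit-lift : ∀ M → k ℕ.+ 1 ≤ M → ∀ x (a j : ℤ) → P ^ M ∣ F x - a → ∀ i → ¬ p ℕ∣.∣ ∣ x i ∣ →
      ∃ λ x′ → P ^ suc M ∣ F x′ - (a + j * P ^ M)
    unit-lift M k+1≤M x a j (divides q Fx-a≡qPM) i p∤xᵢ = lift (p-adic-split p p-prime k)
      where
      lift : (∃₂ λ v k′ → k ≡ p ℕ.^ v ℕ.* k′ × ¬ p ℕ∣.∣ k′ × v ℕ.+ v ≤ k) → ∃ λ x′ → P ^ suc M ∣ F x′ - (a + j * P ^ M)
      lift (v , k′ , k≡ , p∤k′ , v+v≤k) = x′ , subst (P ^ suc M ∣_) (sym change) (∣m∣n⇒∣m+n P^M+1∣linear P^M+1∣quadratic)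
        where
        u : ℤ
        u = c i * + k′ * x i ^ (k ∸ 1)
        p∤u : ¬ p ℕ∣.∣ ∣ u ∣
        p∤u = subst (λ n → ¬ p ℕ∣.∣ n) (sym (trans (abs-* (c i * + k′) _) (cong₂ ℕ._*_ (abs-* (c i) (+ k′)) (abs-^ (x i) (k ∸ 1)))))
                    (∤-* p p-prime (∤-* p p-prime (c-units i) p∤k′) (∤-^ p p-prime (k ∸ 1) p∤xᵢ))
        U z : ℤ
        U = proj₁ (inverse-mod-p p p-prime u p∤u)
        z = proj₁ (proj₂ (inverse-mod-p p p-prime u p∤u))
        uU-1≡zP : u * U - 1ℤ ≡ z * P
        uU-1≡zP = proj₂ (proj₂ (inverse-mod-p p p-prime u p∤u))
        s : ℕ
        s = M ∸ v
        bounds : v ℕ.+ s ≡ M × suc M ≤ s ℕ.+ s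
        bounds = halving {v} {k} {M} v+v≤k k+1≤M
        w : ℤ
        w = U * (j - q)
        x′ : Fin t → ℤ
        x′ = shift x i (P ^ s * w)
        R : ℤ
        R = proj₁ (shift-change v k′ k≡ x i s w)
        change : F x′ - (a + j * P ^ M) ≡ P ^ M * ((j - q) * (u * U - 1ℤ)) + P ^ (s ℕ.+ s) * R
        change = begin
          F x′ - (a + j * P ^ M)                                                 ≡⟨ cong (_- (a + j * P ^ M)) (proj₂ (shift-change v k′ k≡ x i s w)) ⟩
          F x + P ^ (v ℕ.+ s) * (u * w) + P ^ (s ℕ.+ s) * R - (a + j * P ^ M)
                                                                                 ≡⟨ cong₂ (λ f e → f + P ^ e * (u * w) + P ^ (s ℕ.+ s) * R - (a + j * P ^ M)) Fx≡ (proj₁ bounds) ⟩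
          (a + q * P ^ M) + P ^ M * (u * (U * (j - q))) + P ^ (s ℕ.+ s) * R - (a + j * P ^ M)
                                                                                 ≡⟨ collect a q (P ^ M) u U j (P ^ (s ℕ.+ s) * R) ⟩
          P ^ M * ((j - q) * (u * U - 1ℤ)) + P ^ (s ℕ.+ s) * R                   ∎
          where
          open ≡-Reasoning
          add-back : ∀ f a → f ≡ a + (f - a)
          add-back = solve-∀
          Fx≡ : F x ≡ a + q * P ^ M
          Fx≡ = trans (add-back (F x) a) (cong (_+_ a) Fx-a≡qPM)
          collect : ∀ a q PM u U j R → (a + q * PM) + PM * (u * (U * (j - q))) + R - (a + j * PM) ≡ PM * ((j - q) * (u * U - 1ℤ)) + R
          collect = solve-∀
        -- The linear term vanishes mod p^(M+1) by the choice of U, the quadratic one since 2 s > M.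
        P^M+1∣linear : P ^ suc M ∣ P ^ M * ((j - q) * (u * U - 1ℤ))
        P^M+1∣linear = divides ((j - q) * z) (trans (cong (λ e → P ^ M * ((j - q) * e)) uU-1≡zP) (rotate (P ^ M) (j - q) z P))
          where
          rotate : ∀ PM d z P → PM * (d * (z * P)) ≡ d * z * (P * PM)
          rotate = solve-∀
        P^M+1∣quadratic : P ^ suc M ∣ P ^ (s ℕ.+ s) * R
        P^M+1∣quadratic = ∣-trans (^-∣ P (proj₂ bounds)) (divides R (*-comm (P ^ (s ℕ.+ s)) R))

    -- For M ≥ k + 1 every element of N_{p^(M+1)} is a multiple of p^k: a solution with a unit
    -- coordinate would lift, so all coordinates of the underlying solution are divisible by p.
    defect-divisible : ∀ M → k ℕ.+ 1 ≤ M → ∀ b → InAsub c k (p ℕ.^ M) p b → ¬ InA c k (p ℕ.* p ℕ.^ M) b → p ℕ.^ k ℕ∣.∣ b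
    defect-divisible M k+1≤M b (a , (a<p^M , x , p^M∣) , j , j<p , refl) b∉A = by-cases (all? (λ i → p ℕ∣.∣? ∣ x i ∣))
      where
      k≤M : k ≤ M
      k≤M = ≤-trans (m≤m+n k 1) k+1≤M
      P^M∣Fx-a : P ^ M ∣ F x - + a
      P^M∣Fx-a = subst (_∣ F x - + a) (pos-^ p M) (∣ᵤ⇒∣ {+ (p ℕ.^ M)} {F x - + a} p^M∣)
      +b≡ : + (a ℕ.+ j ℕ.* p ℕ.^ M) ≡ + a + + j * P ^ M
      +b≡ = trans (pos-+ a (j ℕ.* p ℕ.^ M)) (cong (_+_ (+ a)) (trans (pos-* j (p ℕ.^ M)) (cong (+ j *_) (pos-^ p M))))
      by-cases : Dec (∀ i → p ℕ∣.∣ ∣ x i ∣) → p ℕ.^ k ℕ∣.∣ a ℕ.+ j ℕ.* p ℕ.^ M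
      by-cases (yes p∣x) = ∣⇒∣ᵤ (subst₂ _∣_ (sym (pos-^ p k)) (sym +b≡)
        (∣m∣n⇒∣m+n (non-unit-solution M k≤M x (+ a) P^M∣Fx-a p∣x) (∣n⇒∣m*n (+ j) (^-∣ P k≤M))))
      by-cases (no ¬all) = ⊥-elim (b∉A (digit-bound a<p^M j<p , lifted (¬∀⟶∃¬ t _ (λ i → p ℕ∣.∣? ∣ x i ∣) ¬all)))
        where
        lifted : (∃ λ i → ¬ p ℕ∣.∣ ∣ x i ∣) → ∃ λ x′ → + (p ℕ.* p ℕ.^ M) ∣ᵤ F x′ - + (a ℕ.+ j ℕ.* p ℕ.^ M)
        lifted (i , p∤xᵢ) =
          let x′ , P^M+1∣ = unit-lift M k+1≤M x (+ a) (+ j) P^M∣Fx-a i p∤xᵢ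
          in x′ , ∣⇒∣ᵤ (subst₂ _∣_ (sym (pos-^ p (suc M))) (cong (F x′ -_) (sym +b≡)) P^M+1∣)


module Horner where

  open import Data.Nat as ℕ using (ℕ; zero; suc; _+_; _*_; _∸_; _^_; _<_; s≤s)
  open import Data.Nat.Properties as ℕₚ using (≤-refl; m<n⇒m<1+n; +-∸-assoc; n∸n≡0; *-identityʳ; *-identityˡ)
  open import Data.Nat.Tactic.RingSolver using () renaming (solve-∀ to ℕ-solve-∀)
  open import Data.List using (map; upTo; [_])
  open import Data.List.Properties using (map-++; upTo-∷ʳ)
  open import Data.Nat.ListAction using (sum)
  open import Data.Nat.ListAction.Properties using (sum-++)
  open import Data.Integer as ℤ using (ℤ; +_; 1ℤ)
  open import Data.Integer.Properties using (pos-*; pos-+)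
  open import Data.Integer.Tactic.RingSolver using (solve-∀)
  open import Relation.Binary.PropositionalEquality hiding ([_])
  open import Defs using (sumFromTo)

  -- horner p g m = Σ_{j=2}^{m+1} g j p^(m+1-j), evaluated by Horner's rule.
  horner : ℕ → (ℕ → ℕ) → ℕ → ℕ
  horner p g zero = 0
  horner p g (suc m) = p * horner p g m + g (2 + m)

  horner-cong : ∀ p g g′ m → (∀ i → i < m → g (2 + i) ≡ g′ (2 + i)) → horner p g m ≡ horner p g′ m
  horner-cong p g g′ zero _ = refl
  horner-cong p g g′ (suc m) g≗g′ =
    cong₂ (λ H x → p * H + x) (horner-cong p g g′ m (λ i i<m → g≗g′ i (m<n⇒m<1+n i<m))) (g≗g′ m ≤-refl)

  private
    Σ< : ℕ → (ℕ → ℕ) → ℕ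
    Σ< m f = sum (map f (upTo m))

    Σ<-suc : ∀ m f → Σ< (suc m) f ≡ Σ< m f + f m
    Σ<-suc m f = begin
      sum (map f (upTo (suc m)))              ≡⟨ cong (λ l → sum (map f l)) (sym (upTo-∷ʳ m)) ⟩
      sum (map f (upTo m Data.List.++ [ m ])) ≡⟨ cong sum (map-++ f (upTo m) [ m ]) ⟩
      sum (map f (upTo m) Data.List.++ [ f m ]) ≡⟨ sum-++ (map f (upTo m)) [ f m ] ⟩
      Σ< m f + (f m + 0)                      ≡⟨ cong (_+_ (Σ< m f)) (ℕₚ.+-identityʳ (f m)) ⟩
      Σ< m f + f m                            ∎
      where open ≡-Reasoning

    Σ<-cong : ∀ m f g → (∀ i → i < m → f i ≡ g i) → Σ< m f ≡ Σ< m g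
    Σ<-cong zero f g _ = refl
    Σ<-cong (suc m) f g f≗g = trans (Σ<-suc m f)
      (trans (cong₂ _+_ (Σ<-cong m f g (λ i i<m → f≗g i (m<n⇒m<1+n i<m))) (f≗g m ≤-refl)) (sym (Σ<-suc m g)))

    Σ<-*ˡ : ∀ m c f → Σ< m (λ i → c * f i) ≡ c * Σ< m f
    Σ<-*ˡ zero c f = sym (ℕₚ.*-zeroʳ c)
    Σ<-*ˡ (suc m) c f = trans (Σ<-suc m _) (trans (cong (_+ c * f m) (Σ<-*ˡ m c f))
      (trans (sym (ℕₚ.*-distribˡ-+ c (Σ< m f) (f m))) (cong (c *_) (sym (Σ<-suc m f)))))

  sumFromTo-horner : ∀ p g m → sumFromTo 2 (suc m) (λ j → g j * p ^ (suc m ∸ j)) ≡ horner p g m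
  sumFromTo-horner p g zero = refl
  sumFromTo-horner p g (suc m) = begin
    Σ< (suc m) (λ i → g (2 + i) * p ^ (m ∸ i))                    ≡⟨ Σ<-suc m _ ⟩
    Σ< m (λ i → g (2 + i) * p ^ (m ∸ i)) + g (2 + m) * p ^ (m ∸ m) ≡⟨ cong₂ _+_ (Σ<-cong m _ _ pull-p) last-term ⟩
    Σ< m (λ i → p * (g (2 + i) * p ^ (m ∸ suc i))) + g (2 + m)      ≡⟨ cong (_+ g (2 + m)) (Σ<-*ˡ m p _) ⟩
    p * Σ< m (λ i → g (2 + i) * p ^ (m ∸ suc i)) + g (2 + m)        ≡⟨ cong (λ H → p * H + g (2 + m)) (sumFromTo-horner p g m) ⟩
    p * horner p g m + g (2 + m)                                    ∎
    where
    open ≡-Reasoning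
    pull-p : ∀ i → i < m → g (2 + i) * p ^ (m ∸ i) ≡ p * (g (2 + i) * p ^ (m ∸ suc i))
    pull-p i (s≤s i≤m-1) = trans (cong (λ e → g (2 + i) * p ^ e) (+-∸-assoc 1 i≤m-1)) (swap (g (2 + i)) p (p ^ (m ∸ suc i)))
      where
      swap : ∀ a p b → a * (p * b) ≡ p * (a * b)
      swap = ℕ-solve-∀
    last-term : g (2 + m) * p ^ (m ∸ m) ≡ g (2 + m)
    last-term = trans (cong (λ e → g (2 + m) * p ^ e) (n∸n≡0 m)) (*-identityʳ _)

  module _ (p k : ℕ) (g : ℕ → ℕ) (periodic : ∀ m → g (2 + (m + k)) ≡ g (2 + m)) where

    private
      H = horner p g

    horner-shift : ∀ m → H (m + k) ≡ H m + p ^ m * H k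
    horner-shift zero = sym (*-identityˡ (H k))
    horner-shift (suc m) = begin
      p * H (m + k) + g (2 + (m + k))     ≡⟨ cong₂ (λ x y → p * x + y) (horner-shift m) (periodic m) ⟩
      p * (H m + p ^ m * H k) + g (2 + m) ≡⟨ regroup p (H m) (p ^ m) (H k) (g (2 + m)) ⟩
      (p * H m + g (2 + m)) + p * p ^ m * H k ∎
      where
      open ≡-Reasoning
      regroup : ∀ p E P S D → p * (E + P * S) + D ≡ (p * E + D) + p * P * S
      regroup = ℕ-solve-∀

    horner-residue : ∀ q r → (+ (p ^ k) ℤ.- 1ℤ) ℤ.* + H (q * k + r)
      ≡ (+ (p ^ k) ℤ.- 1ℤ) ℤ.* + H r ℤ.+ (+ (p ^ (q * k + r)) ℤ.- + (p ^ r)) ℤ.* + H k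
    horner-residue zero r = no-change (+ (p ^ k)) (+ H r) (+ (p ^ r)) (+ H k)
      where
      no-change : ∀ K E P S → (K ℤ.- 1ℤ) ℤ.* E ≡ (K ℤ.- 1ℤ) ℤ.* E ℤ.+ (P ℤ.- P) ℤ.* S
      no-change = solve-∀
    horner-residue (suc q) r = begin
      K-1 ℤ.* + H ((k + q * k) + r)                         ≡⟨ cong (λ n → K-1 ℤ.* + H n) reorder ⟩
      K-1 ℤ.* + H (n + k)                                   ≡⟨ cong (λ x → K-1 ℤ.* + x) (horner-shift n) ⟩
      K-1 ℤ.* + (H n + p ^ n * H k)                         ≡⟨ cong (K-1 ℤ.*_) (trans (pos-+ (H n) _) (cong (ℤ._+_ (+ H n)) (pos-* (p ^ n) (H k)))) ⟩
      K-1 ℤ.* (+ H n ℤ.+ + (p ^ n) ℤ.* + H k)               ≡⟨ distrib K-1 (+ H n) (+ (p ^ n)) (+ H k) ⟩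
      K-1 ℤ.* + H n ℤ.+ K-1 ℤ.* + (p ^ n) ℤ.* + H k         ≡⟨ cong (ℤ._+ K-1 ℤ.* + (p ^ n) ℤ.* + H k) (horner-residue q r) ⟩
      K-1 ℤ.* + H r ℤ.+ (+ (p ^ n) ℤ.- + (p ^ r)) ℤ.* + H k ℤ.+ K-1 ℤ.* + (p ^ n) ℤ.* + H k
                                                            ≡⟨ collect (+ (p ^ k)) (+ H r) (+ (p ^ n)) (+ (p ^ r)) (+ H k) ⟩
      K-1 ℤ.* + H r ℤ.+ (+ (p ^ n) ℤ.* + (p ^ k) ℤ.- + (p ^ r)) ℤ.* + H k
                                                            ≡⟨ cong (λ x → K-1 ℤ.* + H r ℤ.+ (x ℤ.- + (p ^ r)) ℤ.* + H k) p^[n+k] ⟩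
      K-1 ℤ.* + H r ℤ.+ (+ (p ^ ((k + q * k) + r)) ℤ.- + (p ^ r)) ℤ.* + H k ∎
      where
      open ≡-Reasoning
      n : ℕ
      n = q * k + r
      K-1 : ℤ
      K-1 = + (p ^ k) ℤ.- 1ℤ
      reorder : (k + q * k) + r ≡ n + k
      reorder = shuffle k (q * k) r
        where
        shuffle : ∀ a b c → (a + b) + c ≡ (b + c) + a
        shuffle = ℕ-solve-∀
      p^[n+k] : + (p ^ n) ℤ.* + (p ^ k) ≡ + (p ^ ((k + q * k) + r))
      p^[n+k] = trans (sym (pos-* (p ^ n) (p ^ k))) (cong +_ (trans (sym (ℕₚ.^-distribˡ-+-* p n k)) (cong (p ^_) (sym reorder))))
      distrib : ∀ K E P S → K ℤ.* (E ℤ.+ P ℤ.* S) ≡ K ℤ.* E ℤ.+ K ℤ.* P ℤ.* S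
      distrib = solve-∀
      collect : ∀ K Er P Pr S → (K ℤ.- 1ℤ) ℤ.* Er ℤ.+ (P ℤ.- Pr) ℤ.* S ℤ.+ (K ℤ.- 1ℤ) ℤ.* P ℤ.* S
                               ≡ (K ℤ.- 1ℤ) ℤ.* Er ℤ.+ (P ℤ.* K ℤ.- Pr) ℤ.* S
      collect = solve-∀


module Recurrence where

  open import Data.Nat as ℕ using (ℕ; zero; suc; _+_; _*_; _∸_; _^_; _<_; _≤_; NonZero; _%_; s≤s; z≤n)
  open import Data.Nat.Properties as ℕₚ using (m^n≢0; ^-distribˡ-+-*)
  open import Data.Nat.DivMod using ([m+n]%n≡m%n; m<n⇒m%n≡m; m≡m%n+[m/n]*n; m*n%n≡0; m*n/n≡m)
  import Data.Nat.Divisibility as ℕ∣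
  open import Data.Nat.Primality using (Prime; prime⇒nonZero)
  open import Data.Nat.Tactic.RingSolver using () renaming (solve-∀ to ℕ-solve-∀)
  open import Data.Fin using (Fin)
  open import Data.Integer as ℤ using (ℤ; 1ℤ)
  open import Data.Integer.Properties using (pos-+)
  open import Data.Integer.Tactic.RingSolver using (solve-∀)
  open import Data.Integer.Divisibility using () renaming (_∣_ to _∣ᵤ_)
  open import Data.Product using (_,_; proj₁; proj₂)
  open import Data.Sum using (inj₁; inj₂)
  open import Relation.Nullary using (¬_; Dec; yes; no)
  open import Relation.Nullary.Decidable using (_×-dec_; ¬?)
  open import Relation.Binary.PropositionalEquality
  open import Defs using (InA; InAsub; InN; IsExponent)
  open Counting
  open DiagonalForm using (InA?)
  open Residues using (InA-reduce; InAsub⇒; InAsub⇐; InAsub?)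
  open Scaling using (InA-scale; InAsub-scale; InA-unscale; InAsub-unscale)
  open Hensel using (defect-divisible)
  open Horner using (horner; horner-residue)

  module Counts {t : ℕ} (c : Fin t → ℤ) (k p : ℕ) .{{_ : NonZero k}} (p-prime : Prime p)
           (c-units : ∀ i → ¬ ℤ.+ p ∣ᵤ c i) (e : ℕ) (e-exponent : IsExponent c k p e) (e∣k : e ℕ∣.∣ k) where

    private
      instance
        p≢0 : NonZero p
        p≢0 = prime⇒nonZero p-prime
        K≢0 : NonZero (p ^ k)
        K≢0 = m^n≢0 p k
      K : ℕ
      K = p ^ k
      p^≢0 : ∀ n → NonZero (p ^ n)
      p^≢0 n = m^n≢0 p n

    InN? : ∀ j b → Dec (InN c k p j b)
    InN? j b = InAsub? c k (p ^ (j ∸ 1)) {{p^≢0 (j ∸ 1)}} p b ×-dec ¬? (InA? c k (p ^ j) {{p^≢0 j}} b)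

    -- α n = α(p^n) and defect j = n_j = |N_{p^j}|.
    α : ℕ → ℕ
    α n = count (InA? c k (p ^ n) {{p^≢0 n}}) (p ^ n)

    defect : ℕ → ℕ
    defect j = count (InN? j) (p ^ j)

    -- Lifting count: α(p^(n+1)) + n_{n+1} = p α(p^n), since A_{p^(n+1)}(p^n) consists of
    -- p translates of A_{p^n}.
    lifting-count : ∀ n → α (suc n) + defect (suc n) ≡ p * α n
    lifting-count n = begin
      α (suc n) + defect (suc n)      ≡⟨ sym partition ⟩
      count (InAsub? c k m p) (p * m) ≡⟨ by-residue ⟩
      count S? (p * m)                ≡⟨ count-periodic S? m (λ x → subst (InA c k m) (shift-% x)) (λ x → subst (InA c k m) (sym (shift-% x))) p ⟩
      p * count S? m                  ≡⟨ cong (p *_) below-m ⟩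
      p * α n                         ∎
      where
      open ≡-Reasoning
      m : ℕ
      m = p ^ n
      instance
        m≢0 : NonZero m
        m≢0 = p^≢0 n
        pm≢0 : NonZero (p * m)
        pm≢0 = p^≢0 (suc n)
      S? : ∀ b → Dec (InA c k m (b % m))
      S? b = InA? c k m (b % m)
      shift-% : ∀ x → (m + x) % m ≡ x % m
      shift-% x = trans (cong (_% m) (ℕₚ.+-comm m x)) ([m+n]%n≡m%n x m)
      split : ∀ b → b < p * m → InAsub c k m p b → _
      split b _ b∈sub with InA? c k (p * m) b
      ... | yes b∈A = inj₁ b∈A
      ... | no b∉A = inj₂ (b∈sub , b∉A)
      fromA : ∀ b → b < p * m → InA c k (p * m) b → InAsub c k m p b
      fromA b b<pm b∈A = InAsub⇐ c k m p b b<pm (InA-reduce c k p m b b∈A)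
      partition : count (InAsub? c k m p) (p * m) ≡ α (suc n) + defect (suc n)
      partition = count-⊎ (InAsub? c k m p) (InA? c k (p * m)) (InN? (suc n)) (p * m)
                          split fromA (λ _ _ → proj₁) (λ _ b∈A b∈N → proj₂ b∈N b∈A)
      by-residue : count (InAsub? c k m p) (p * m) ≡ count S? (p * m)
      by-residue = count-cong _ S? (p * m) (λ b _ b∈sub → proj₂ (InAsub⇒ c k m p b b∈sub)) (λ b b<pm → InAsub⇐ c k m p b b<pm)
      below-m : count S? m ≡ α n
      below-m = count-cong S? (InA? c k m) m (λ b b<m → subst (InA c k m) (m<n⇒m%n≡m b<m))
                                             (λ b b<m → subst (InA c k m) (sym (m<n⇒m%n≡m b<m)))

    private
      p^[k+i] : ∀ i → p ^ (k + i) ≡ K * p ^ i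
      p^[k+i] i = ^-distribˡ-+-* p k i
      p^[1+k+i] : ∀ i → p ^ suc (k + i) ≡ K * p ^ suc i
      p^[1+k+i] i = trans (cong (p *_) (p^[k+i] i)) (swap p K (p ^ i))
        where
        swap : ∀ p K m → p * (K * m) ≡ K * (p * m)
        swap = ℕ-solve-∀

    N-scale : ∀ i q → InN c k p (suc i) q → InN c k p (suc (k + i)) (K * q)
    N-scale i q (q∈sub , q∉A) =
      subst (λ M → InAsub c k M p (K * q)) (sym (p^[k+i] i)) (InAsub-scale c k p (p ^ i) p q q∈sub) ,
      λ Kq∈A → q∉A (InA-unscale c k p e e-exponent e∣k (p ^ suc i) q (subst (λ M → InA c k M (K * q)) (p^[1+k+i] i) Kq∈A))

    N-unscale : ∀ i q → InN c k p (suc (k + i)) (K * q) → InN c k p (suc i) q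
    N-unscale i q (Kq∈sub , Kq∉A) =
      InAsub-unscale c k p e e-exponent e∣k (p ^ i) p q (subst (λ M → InAsub c k M p (K * q)) (p^[k+i] i) Kq∈sub) ,
      λ q∈A → Kq∉A (subst (λ M → InA c k M (K * q)) (sym (p^[1+k+i] i)) (InA-scale c k p (p ^ suc i) q q∈A))

    -- For j ≥ 2, N_{p^(j+k)} = p^k N_{p^j} (by Hensel's lemma and scaling), so n_{j+k} = n_j.
    defect-periodic : ∀ i → 1 ≤ i → defect (suc (k + i)) ≡ defect (suc i)
    defect-periodic i 1≤i = begin
      count (InN? (suc (k + i))) (p ^ suc (k + i))      ≡⟨ cong (count (InN? (suc (k + i)))) (trans (p^[1+k+i] i) (ℕₚ.*-comm K _)) ⟩
      count (InN? (suc (k + i))) (p ^ suc i * K)        ≡⟨ count-cong _ (Multiple? K (InN? (suc i))) (p ^ suc i * K) (λ b _ → to b) (λ b _ → from b) ⟩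
      count (Multiple? K (InN? (suc i))) (p ^ suc i * K) ≡⟨ count-multiples K (InN? (suc i)) (p ^ suc i) ⟩
      count (InN? (suc i)) (p ^ suc i)                  ∎
      where
      open ≡-Reasoning
      to : ∀ b → InN c k p (suc (k + i)) b → Multiple K (InN c k p (suc i)) b
      to b b∈N with defect-divisible c k p p-prime c-units (k + i) (ℕₚ.+-monoʳ-≤ k 1≤i) b (proj₁ b∈N) (proj₂ b∈N)
      ... | ℕ∣.divides q refl = m*n%n≡0 q K , subst (InN c k p (suc i)) (sym (m*n/n≡m q K))
                                                   (N-unscale i q (subst (InN c k p (suc (k + i))) (ℕₚ.*-comm q K) b∈N))
      from : ∀ b → Multiple K (InN c k p (suc i)) b → InN c k p (suc (k + i)) b
      from b (b%K≡0 , b/K∈N) = subst (InN c k p (suc (k + i))) (sym b≡K*[b/K]) (N-scale i (b ℕ./ K) b/K∈N)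
        where
        b≡K*[b/K] : b ≡ K * (b ℕ./ K)
        b≡K*[b/K] = trans (m≡m%n+[m/n]*n b K) (trans (cong (_+ (b ℕ./ K) * K) b%K≡0) (ℕₚ.*-comm (b ℕ./ K) K))

    H : ℕ → ℕ
    H = horner p defect

    α-unrolled : ∀ m → α (suc m) + H m ≡ p ^ m * α 1
    α-unrolled zero = trans (ℕₚ.+-identityʳ (α 1)) (sym (ℕₚ.*-identityˡ (α 1)))
    α-unrolled (suc m) = begin
      α (2 + m) + (p * H m + defect (2 + m))   ≡⟨ swap (α (2 + m)) (p * H m) (defect (2 + m)) ⟩
      (α (2 + m) + defect (2 + m)) + p * H m   ≡⟨ cong (_+ p * H m) (lifting-count (suc m)) ⟩
      p * α (suc m) + p * H m                  ≡⟨ sym (ℕₚ.*-distribˡ-+ p (α (suc m)) (H m)) ⟩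
      p * (α (suc m) + H m)                    ≡⟨ cong (p *_) (α-unrolled m) ⟩
      p * (p ^ m * α 1)                        ≡⟨ sym (ℕₚ.*-assoc p (p ^ m) (α 1)) ⟩
      p ^ suc m * α 1                          ∎
      where
      open ≡-Reasoning
      swap : ∀ x y z → x + (y + z) ≡ (x + z) + y
      swap = ℕ-solve-∀

    defect-periodic-from-2 : ∀ m → defect (2 + (m + k)) ≡ defect (2 + m)
    defect-periodic-from-2 m =
      trans (cong (λ n → defect (suc n)) (trans (cong suc (ℕₚ.+-comm m k)) (sym (ℕₚ.+-suc k m))))
            (defect-periodic (suc m) (s≤s z≤n))

    α-formula : ∀ q r →
      (ℤ.+ K ℤ.- 1ℤ) ℤ.* ℤ.+ α (suc (q * k + r))
        ≡ (ℤ.+ K ℤ.- 1ℤ) ℤ.* ℤ.+ (p ^ (q * k + r) * α 1)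
          ℤ.- (ℤ.+ (p ^ (q * k + r)) ℤ.- ℤ.+ (p ^ r)) ℤ.* ℤ.+ H k
          ℤ.- (ℤ.+ K ℤ.- 1ℤ) ℤ.* ℤ.+ H r
    α-formula q r = solve-for-α (ℤ.+ K ℤ.- 1ℤ) (ℤ.+ α (suc n)) (ℤ.+ H n) _ _ (ℤ.+ H r)
      (trans (cong ℤ.+_ (sym (α-unrolled n))) (pos-+ (α (suc n)) (H n)))
      (horner-residue p k defect defect-periodic-from-2 q r)
      where
      n : ℕ
      n = q * k + r
      solve-for-α : ∀ K₁ a E A₁ D Eᵣ → A₁ ≡ a ℤ.+ E → K₁ ℤ.* E ≡ K₁ ℤ.* Eᵣ ℤ.+ D → K₁ ℤ.* a ≡ K₁ ℤ.* A₁ ℤ.- D ℤ.- K₁ ℤ.* Eᵣ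
      solve-for-α K₁ a E A₁ D Eᵣ refl K₁E≡ = begin
        K₁ ℤ.* a                                                           ≡⟨ isolate K₁ a E Eᵣ ⟩
        K₁ ℤ.* (a ℤ.+ E) ℤ.- (K₁ ℤ.* E ℤ.- K₁ ℤ.* Eᵣ) ℤ.- K₁ ℤ.* Eᵣ          ≡⟨ cong (λ z → K₁ ℤ.* (a ℤ.+ E) ℤ.- (z ℤ.- K₁ ℤ.* Eᵣ) ℤ.- K₁ ℤ.* Eᵣ) K₁E≡ ⟩
        K₁ ℤ.* (a ℤ.+ E) ℤ.- (K₁ ℤ.* Eᵣ ℤ.+ D ℤ.- K₁ ℤ.* Eᵣ) ℤ.- K₁ ℤ.* Eᵣ ≡⟨ cancel (K₁ ℤ.* (a ℤ.+ E)) (K₁ ℤ.* Eᵣ) D ⟩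
        K₁ ℤ.* (a ℤ.+ E) ℤ.- D ℤ.- K₁ ℤ.* Eᵣ                               ∎
        where
        open ≡-Reasoning
        isolate : ∀ K₁ a E Eᵣ → K₁ ℤ.* a ≡ K₁ ℤ.* (a ℤ.+ E) ℤ.- (K₁ ℤ.* E ℤ.- K₁ ℤ.* Eᵣ) ℤ.- K₁ ℤ.* Eᵣ
        isolate = solve-∀
        cancel : ∀ X Y D → X ℤ.- (Y ℤ.+ D ℤ.- Y) ℤ.- Y ≡ X ℤ.- D ℤ.- Y
        cancel = solve-∀


module ClosedForm where

  open import Data.Nat as ℕ using (ℕ; zero; suc; _+_; _*_; _∸_; _^_; _<_; _≤_; NonZero; _%_; _/_; s≤s; z≤n)
  open import Data.Nat.Properties as ℕₚ using (m≤n⇒m<n∨m≡n; suc-injective; <-≤-trans; ≤-refl)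
  open import Data.Nat.DivMod using (m≡m%n+[m/n]*n; m<n⇒m%n≡m; n%n≡0)
  import Data.Nat.Divisibility as ℕ∣
  open import Data.Nat.Primality using (Prime)
  open import Data.Fin using (Fin)
  open import Data.Integer as ℤ using (ℤ; +_)
  open import Data.Integer.Divisibility using () renaming (_∣_ to _∣ᵤ_)
  open import Data.Product using (∃; _,_)
  open import Data.Sum using (inj₁; inj₂)
  open import Relation.Nullary using (¬_)
  open import Data.Integer.Tactic.RingSolver using (solve-∀)
  open import Relation.Binary.PropositionalEquality
  open import Defs using (InA; InN; IsExponent; HasSize; sumFromTo)
  open Counting using (hasSize-count; hasSize-unique)
  open Horner using (horner-cong; sumFromTo-horner)
  open Recurrence using (module Counts)

  residue-decomposition : ∀ k .{{_ : NonZero k}} n r₀ → r₀ < k → suc n % k ≡ suc r₀ % k → ∃ λ q → n ≡ q * k + r₀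
  residue-decomposition k n r₀ r₀<k 1+n≡1+r₀ with m≤n⇒m<n∨m≡n r₀<k | suc n / k in quotient
  ... | inj₁ 1+r₀<k | q = q , suc-injective (begin
    suc n                      ≡⟨ m≡m%n+[m/n]*n (suc n) k ⟩
    suc n % k + suc n / k * k  ≡⟨ cong₂ (λ r d → r + d * k) (trans 1+n≡1+r₀ (m<n⇒m%n≡m 1+r₀<k)) quotient ⟩
    suc r₀ + q * k             ≡⟨ cong suc (ℕₚ.+-comm r₀ (q * k)) ⟩
    suc (q * k + r₀)           ∎)
    where open ≡-Reasoning
  ... | inj₂ refl | d = of-multiple d (trans (m≡m%n+[m/n]*n (suc n) k) (cong₂ (λ r d → r + d * k) (trans 1+n≡1+r₀ (n%n≡0 k)) quotient))
    where
    of-multiple : ∀ d → suc n ≡ d * k → ∃ λ q → n ≡ q * k + r₀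
    of-multiple zero ()
    of-multiple (suc q) 1+n≡ = q , suc-injective (trans 1+n≡ (cong suc (ℕₚ.+-comm r₀ (q * k))))

  module Formulas {t : ℕ} (c : Fin t → ℤ) (k p : ℕ) .{{_ : NonZero k}} (p-prime : Prime p)
           (c-units : ∀ i → ¬ + p ∣ᵤ c i) (e : ℕ) (e-exponent : IsExponent c k p e) (e∣k : e ℕ∣.∣ k)
           (α₁ : ℕ) (α₁-size : HasSize p (InA c k p) α₁)
           (nn : ℕ → ℕ) (nn-size : ∀ j → 2 ≤ j → j ≤ k + 1 → HasSize (p ^ j) (InN c k p j) (nn j)) where

    open Counts c k p p-prime c-units e e-exponent e∣k public using (α)
    open Counts c k p p-prime c-units e e-exponent e∣k using (defect; H; α-formula)

    α₁≡ : α 1 ≡ α₁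
    α₁≡ = hasSize-unique (subst (λ q → HasSize q (InA c k q) (α 1)) (ℕₚ.*-identityʳ p) (hasSize-count _ (p ^ 1))) α₁-size

    nn≡defect : ∀ i → i < k → nn (2 + i) ≡ defect (2 + i)
    nn≡defect i i<k = hasSize-unique (nn-size (2 + i) (s≤s (s≤s z≤n)) (subst (2 + i ≤_) (ℕₚ.+-comm 1 k) (s≤s i<k)))
                                     (hasSize-count _ (p ^ (2 + i)))

    K-1 : ℤ
    K-1 = + (p ^ k) ℤ.- + 1

    Sum : ℕ → ℕ
    Sum r = sumFromTo 2 r (λ j → nn j * p ^ (r ∸ j))

    S : ℕ
    S = Sum (k + 1)

    sum≡H : ∀ r₀ → r₀ ≤ k → Sum (suc r₀) ≡ H r₀
    sum≡H r₀ r₀≤k = trans (sumFromTo-horner p nn r₀) (horner-cong p nn defect r₀ (λ i i<r₀ → nn≡defect i (<-≤-trans i<r₀ r₀≤k)))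

    full-sum≡H : S ≡ H k
    full-sum≡H = trans (cong Sum (ℕₚ.+-comm k 1)) (sum≡H k ≤-refl)

    closed-form : ∀ m r₀ → r₀ < k → suc m % k ≡ suc r₀ % k →
      K-1 ℤ.* + α (suc m) ≡ K-1 ℤ.* + (p ^ m * α₁) ℤ.- (+ (p ^ m) ℤ.- + (p ^ r₀)) ℤ.* + S ℤ.- K-1 ℤ.* + Sum (suc r₀)
    closed-form m r₀ r₀<k 1+m≡1+r₀ with residue-decomposition k m r₀ r₀<k 1+m≡1+r₀
    ... | q , refl = begin
      K-1 ℤ.* + α (suc n)                                                               ≡⟨ α-formula q r₀ ⟩
      K-1 ℤ.* + (p ^ n * α 1) ℤ.- (+ (p ^ n) ℤ.- + (p ^ r₀)) ℤ.* + H k ℤ.- K-1 ℤ.* + H r₀ ≡⟨ cong₂ (λ a S → K-1 ℤ.* + (p ^ n * a) ℤ.- (+ (p ^ n) ℤ.- + (p ^ r₀)) ℤ.* + S ℤ.- K-1 ℤ.* + H r₀)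
                                                                                               α₁≡ (sym full-sum≡H) ⟩
      K-1 ℤ.* + (p ^ n * α₁) ℤ.- (+ (p ^ n) ℤ.- + (p ^ r₀)) ℤ.* + S ℤ.- K-1 ℤ.* + H r₀     ≡⟨ cong (λ Sᵣ → K-1 ℤ.* + (p ^ n * α₁) ℤ.- (+ (p ^ n) ℤ.- + (p ^ r₀)) ℤ.* + S ℤ.- K-1 ℤ.* + Sᵣ)
                                                                                               (sym (sum≡H r₀ (ℕₚ.<⇒≤ r₀<k))) ⟩
      K-1 ℤ.* + (p ^ n * α₁) ℤ.- (+ (p ^ n) ℤ.- + (p ^ r₀)) ℤ.* + S ℤ.- K-1 ℤ.* + Sum (suc r₀) ∎
      where
      open ≡-Reasoning
      n : ℕ
      n = q * k + r₀

    closed-form-1 : ∀ m → suc m % k ≡ 1 % k →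
      K-1 ℤ.* + α (suc m) ≡ K-1 ℤ.* + (p ^ m * α₁) ℤ.- (+ (p ^ m) ℤ.- + 1) ℤ.* + S
    closed-form-1 m 1+m≡1 =
      trans (closed-form m 0 (ℕ.>-nonZero⁻¹ k) 1+m≡1) (drop-zero (K-1 ℤ.* + (p ^ m * α₁)) ((+ (p ^ m) ℤ.- + 1) ℤ.* + S) K-1)
      where
      drop-zero : ∀ X Y Z → X ℤ.- Y ℤ.- Z ℤ.* + 0 ≡ X ℤ.- Y
      drop-zero = solve-∀

open import Defs
open import Data.Nat as ℕ using (ℕ; _≤_; _<_; _∸_; NonZero; _%_; suc; s≤s)
open import Data.Nat.Divisibility using (_∣_)
open import Data.Nat.Primality using (Prime)
open import Data.Fin using (Fin)
open import Data.Integer as ℤ using (ℤ; +_)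
open import Data.Integer.Divisibility using () renaming (_∣_ to _∣ℤ_)
open import Data.Product using (∃; _×_; _,_)
open import Relation.Nullary using (¬_)
open import Relation.Binary.PropositionalEquality
open Counting using (hasSize-count)
open ClosedForm using (module Formulas)

-- Corollary 2.11. For n = m + 1, part (i) is closed-form-1 and part (ii) is closed-form
-- with r₀ = r - 1; the count α(p^n) is the witness.
corollary2p11 : (t k p : ℕ) .{{_ : NonZero k}} (c : Fin t → ℤ) →
    Prime p →
    (∀ i → ¬ ((+ p) ∣ℤ c i)) →
    (∃ λ e → IsExponent c k p e × e ∣ k) →
    (α₁ : ℕ) → HasSize p (InA c k p) α₁ →
    (nn : ℕ → ℕ) →
    (∀ j → 2 ≤ j → j ≤ k ℕ.+ 1 → HasSize (p ℕ.^ j) (InN c k p j) (nn j)) →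
    (n : ℕ) → 1 ≤ n →
    ∃ λ α →
      HasSize (p ℕ.^ n) (InA c k (p ℕ.^ n)) α ×
      ((n % k ≡ 1 % k →
          (+ (p ℕ.^ k) ℤ.- + 1) ℤ.* + α
            ≡ (+ (p ℕ.^ k) ℤ.- + 1) ℤ.* + (p ℕ.^ (n ∸ 1) ℕ.* α₁)
              ℤ.- (+ (p ℕ.^ (n ∸ 1)) ℤ.- + 1)
                  ℤ.* + sumFromTo 2 (k ℕ.+ 1) (λ j → nn j ℕ.* p ℕ.^ (k ℕ.+ 1 ∸ j)))
       ×
       (∀ r → 2 ≤ r → r ≤ k → n % k ≡ r % k →
          (+ (p ℕ.^ k) ℤ.- + 1) ℤ.* + α
            ≡ (+ (p ℕ.^ k) ℤ.- + 1) ℤ.* + (p ℕ.^ (n ∸ 1) ℕ.* α₁)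
              ℤ.- (+ (p ℕ.^ (n ∸ 1)) ℤ.- + (p ℕ.^ (r ∸ 1)))
                  ℤ.* + sumFromTo 2 (k ℕ.+ 1) (λ j → nn j ℕ.* p ℕ.^ (k ℕ.+ 1 ∸ j))
              ℤ.- (+ (p ℕ.^ k) ℤ.- + 1)
                  ℤ.* + sumFromTo 2 r (λ j → nn j ℕ.* p ℕ.^ (r ∸ j))))
corollary2p11 t k p c p-prime c-units (e , e-exponent , e∣k) α₁ α₁-size nn nn-size (suc m) _ =
  α (suc m) , hasSize-count _ (p ℕ.^ suc m) , closed-form-1 m , λ { (suc r₀) (s≤s _) r≤k → closed-form m r₀ r≤k }
  where open Formulas c k p p-prime c-units e e-exponent e∣k α₁ α₁-size nn nn-size
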